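{- If $P\triangleright\Gamma$ is a correct pre-proof graph and $P\triangleright\Gamma\sim P'\triangleright\Gamma$, then $P'\triangleright\Gamma$ is also correct.
   Context: We write $\wp$ for par. Fix a set $\mathcal A$ of atoms. Formulas: $F::=a\mid a^\bot\mid 1\mid\bot\mid F\otimes F\mid F\wp F$ ($a\in\mathcal A$). Linkings: $L::=1\mid a\otimes a^\bot\mid a^\bot\otimes a\mid\bot\otimes L\mid L\otimes\bot\mid L\wp L$. Both are binary trees whose leaves are occurrences of elements of $\mathcal A\cup\mathcal A^\bot\cup\{1,\bot\}$; a sequent is a finite list of formulas. A pre-proof graph $P\triangleright\Gamma$ consists of a linking $P$ and a sequent $\Gamma$ whose leaf occurrences are identified bijectively and label-preservingly (indices such as $\bot_i$ mark identified occurrences); it is the graph obtained by gluing the tree $P$ and forest $\Gamma$ along the leaves. A switching is obtained by deleting, for each $\wp$-node, one of the two edges to its children; $P\triangleright\Gamma$ is correct if every switching is connected and acyclic. For an occurrence $\bot_i$ in $P$, an extended switching w.r.t. $\bot_i$ is a switching from which also the edge between $\bot_i$ and its parent in $P$ is removed. With $P\{Q\}$ a linking with distinguished subtree $Q$ in context $P\{\ \}$, $\sim$ is the smallest equivalence relation on pre-proof graphs such that $P\{Q\wp R\}\triangleright\Gamma\sim P\{R\wp Q\}\triangleright\Gamma$; $P\{(Q\wp R)\wp S\}\triangleright\Gamma\sim P\{Q\wp(R\wp S)\}\triangleright\Gamma$; $P\{Q\otimes R\}\triangleright\Gamma\sim P\{R\otimes Q\}\triangleright\Gamma$; $P\{\bot_i\otimes(Q\otimes\bot_j)\}\triangleright\Gamma\sim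 P\{(\bot_i\otimes Q)\otimes\bot_j\}\triangleright\Gamma$; and $P\{Q\wp(R\otimes\bot_i)\}\triangleright\Gamma\sim P\{(Q\wp R)\otimes\bot_i\}\triangleright\Gamma$ provided that in every extended switching of $P\{Q\wp(R\otimes\bot_i)\}\triangleright\Gamma$ w.r.t. $\bot_i$ no node of $Q$ is connected to $\bot_i$. -}

module Defs where

open import Data.Nat using (ℕ; suc; _≟_)
open import Data.Fin using (Fin)
open import Data.Maybe using (Maybe; just; nothing)
open import Data.List using (List; []; _∷_; _++_; length; lookup; concatMap; map)
open import Data.List.Membership.Propositional using (_∈_)
open import Data.List.Relation.Unary.Unique.Propositional using (Unique)
open import Data.List.Relation.Binary.Permutation.Propositional using (_↭_)
open import Data.Product using (Σ; _×_; _,_; proj₂; ∃)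
open import Data.Sum using (_⊎_)
open import Relation.Binary.PropositionalEquality using (_≡_)
open import Relation.Nullary using (¬_; yes; no)
open import Relation.Binary.Construct.Closure.ReflexiveTransitive using (Star)

-- Formulas and linkings, as binary trees whose leaves are *occurrences*:
-- a label (a, a^⊥, 1, ⊥) paired with an occurrence name (a natural number).
-- The names realise the bijective, label-preserving identification of the
-- leaves of P with the leaves of Γ (the indices ⊥_i of the paper).

data Lit (A : Set) : Set where
  pos : A → Lit A
  neg : A → Lit A
  one : Lit A
  bot : Lit A

Occ : Set → Set
Occ A = Lit A × ℕ

infixr 6 _⊗_
infixr 5 _⅋_

data Tree (A : Set) : Set where
  leaf : Occ A → Tree A
  _⊗_  : Tree A → Tree A → Tree A
  _⅋_  : Tree A → Tree A → Tree A

Sequent : Set → Set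
Sequent A = List (Tree A)

data IsLinking {A : Set} : Tree A → Set where
  lk-one  : ∀ i → IsLinking (leaf (one , i))
  lk-ax   : ∀ a i j → IsLinking (leaf (pos a , i) ⊗ leaf (neg a , j))
  lk-xa   : ∀ a i j → IsLinking (leaf (neg a , i) ⊗ leaf (pos a , j))
  lk-botl : ∀ i {L} → IsLinking L → IsLinking (leaf (bot , i) ⊗ L)
  lk-botr : ∀ i {L} → IsLinking L → IsLinking (L ⊗ leaf (bot , i))
  lk-par  : ∀ {L M} → IsLinking L → IsLinking M → IsLinking (L ⅋ M)

leaves : {A : Set} → Tree A → List (Occ A)
leaves (leaf x) = x ∷ []
leaves (t ⊗ u) = leaves t ++ leaves u
leaves (t ⅋ u) = leaves t ++ leaves u

PreProof : {A : Set} → Tree A → Sequent A → Set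
PreProof P Γ = IsLinking P × Unique (map proj₂ (leaves P)) × (leaves P ↭ concatMap leaves Γ)

-- Vertices: the (identified) leaf occurrences, the inner
-- nodes of P, and the inner nodes of the k-th formula of Γ.  Paths are
-- stored reversed (the last step from the root comes first).

data Dir : Set where
  l r : Dir

Path : Set
Path = List Dir

data Vertex : Set where
  leafV : ℕ → Vertex
  nodeP : Path → Vertex
  nodeΓ : ℕ → Path → Vertex

Edge : Set
Edge = Vertex × Vertex

-- a switching: at each ⅋-node v, s v is the child whose edge is deleted
-- (values at other vertices are irrelevant)
Switching : Set
Switching = Vertex → Dir

rootV : {A : Set} → (Path → Vertex) → Tree A → Path → Vertex
rootV mk (leaf (_ , i)) p = leafV i
rootV mk (_ ⊗ _) p = mk p
rootV mk (_ ⅋ _) p = mk p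

treeVerts : {A : Set} → (Path → Vertex) → Tree A → Path → List Vertex
treeVerts mk (leaf (_ , i)) p = leafV i ∷ []
treeVerts mk (t ⊗ u) p = mk p ∷ treeVerts mk t (l ∷ p) ++ treeVerts mk u (r ∷ p)
treeVerts mk (t ⅋ u) p = mk p ∷ treeVerts mk t (l ∷ p) ++ treeVerts mk u (r ∷ p)

-- the edge between the root of subtree t (at path p) and its parent v;
-- if the first argument is  just i  and t is the leaf occurrence named i,
-- the edge is removed (extended switching w.r.t. that occurrence)
childEdge : {A : Set} → Maybe ℕ → (Path → Vertex) → Tree A → Path → Vertex → List Edge
childEdge nothing mk t p v = (rootV mk t p , v) ∷ []
childEdge (just i) mk (leaf (_ , j)) p v with i ≟ j
... | yes _ = []
... | no _ = (leafV j , v) ∷ []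
childEdge (just i) mk (t ⊗ u) p v = (mk p , v) ∷ []
childEdge (just i) mk (t ⅋ u) p v = (mk p , v) ∷ []

treeEdges : {A : Set} → Maybe ℕ → (Path → Vertex) → Switching → Tree A → Path → List Edge
treeEdges x mk s (leaf _) p = []
treeEdges x mk s (t ⊗ u) p =
  childEdge x mk t (l ∷ p) (mk p) ++ childEdge x mk u (r ∷ p) (mk p)
  ++ treeEdges x mk s t (l ∷ p) ++ treeEdges x mk s u (r ∷ p)
treeEdges x mk s (t ⅋ u) p = kept (s (mk p))
  ++ treeEdges x mk s t (l ∷ p) ++ treeEdges x mk s u (r ∷ p)
  where
  kept : Dir → List Edge
  kept l = childEdge x mk u (r ∷ p) (mk p)
  kept r = childEdge x mk t (l ∷ p) (mk p)

seqEdges : {A : Set} → Switching → Sequent A → ℕ → List Edge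
seqEdges s [] k = []
seqEdges s (F ∷ Γ) k = treeEdges nothing (nodeΓ k) s F [] ++ seqEdges s Γ (suc k)

seqVerts : {A : Set} → Sequent A → ℕ → List Vertex
seqVerts [] k = []
seqVerts (F ∷ Γ) k = treeVerts (nodeΓ k) F [] ++ seqVerts Γ (suc k)

verts : {A : Set} → Tree A → Sequent A → List Vertex
verts P Γ = treeVerts nodeP P [] ++ seqVerts Γ 0

switchGraph : {A : Set} → Maybe ℕ → Switching → Tree A → Sequent A → List Edge
switchGraph x s P Γ = treeEdges x nodeP s P [] ++ seqEdges s Γ 0

data Trail (E : List Edge) : Vertex → Vertex → List (Fin (length E)) → Set where
  nil  : ∀ {u} → Trail E u u []
  step : ∀ {u w v es} (e : Fin (length E)) →
         (lookup E e ≡ (u , w) ⊎ lookup E e ≡ (w , u)) →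
         Trail E w v es → Trail E u v (e ∷ es)

Connected : List Edge → List Vertex → Set
Connected E V = ∀ {u v} → u ∈ V → v ∈ V → ∃ λ es → Trail E u v es

Acyclic : List Edge → Set
Acyclic E = ¬ (Σ Vertex λ u → Σ (Fin (length E)) λ e → Σ (List (Fin (length E))) λ es →
               Trail E u u (e ∷ es) × Unique (e ∷ es))

Correct : {A : Set} → Tree A → Sequent A → Set
Correct P Γ = PreProof P Γ ×
  (∀ (s : Switching) → Connected (switchGraph nothing s P Γ) (verts P Γ)
                     × Acyclic (switchGraph nothing s P Γ))

data Ctx (A : Set) : Set where
  hole : Ctx A
  ⊗ₗ : Ctx A → Tree A → Ctx A
  ⊗ᵣ : Tree A → Ctx A → Ctx A
  ⅋ₗ : Ctx A → Tree A → Ctx A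
  ⅋ᵣ : Tree A → Ctx A → Ctx A

plug : {A : Set} → Ctx A → Tree A → Tree A
plug hole t = t
plug (⊗ₗ c u) t = plug c t ⊗ u
plug (⊗ᵣ u c) t = u ⊗ plug c t
plug (⅋ₗ c u) t = plug c t ⅋ u
plug (⅋ᵣ u c) t = u ⅋ plug c t

holePath : {A : Set} → Ctx A → Path → Path
holePath hole acc = acc
holePath (⊗ₗ c _) acc = holePath c (l ∷ acc)
holePath (⊗ᵣ _ c) acc = holePath c (r ∷ acc)
holePath (⅋ₗ c _) acc = holePath c (l ∷ acc)
holePath (⅋ᵣ _ c) acc = holePath c (r ∷ acc)

SideCond : {A : Set} → Sequent A → Ctx A → Tree A → Tree A → ℕ → Set
SideCond Γ C Q R i =
  ∀ (s : Switching) (v : Vertex) →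
    v ∈ treeVerts nodeP Q (l ∷ holePath C []) →
    ¬ (∃ λ es → Trail (switchGraph (just i) s (plug C (Q ⅋ (R ⊗ leaf (bot , i)))) Γ) v (leafV i) es)

data Step {A : Set} (Γ : Sequent A) : Tree A → Tree A → Set where
  par-comm  : ∀ C Q R → Step Γ (plug C (Q ⅋ R)) (plug C (R ⅋ Q))
  par-assoc : ∀ C Q R S → Step Γ (plug C ((Q ⅋ R) ⅋ S)) (plug C (Q ⅋ (R ⅋ S)))
  ten-comm  : ∀ C Q R → Step Γ (plug C (Q ⊗ R)) (plug C (R ⊗ Q))
  bot-assoc : ∀ C i Q j →
    Step Γ (plug C (leaf (bot , i) ⊗ (Q ⊗ leaf (bot , j))))
           (plug C ((leaf (bot , i) ⊗ Q) ⊗ leaf (bot , j)))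
  switch    : ∀ C Q R i → SideCond Γ C Q R i →
    Step Γ (plug C (Q ⅋ (R ⊗ leaf (bot , i))))
           (plug C ((Q ⅋ R) ⊗ leaf (bot , i)))

SymStep : {A : Set} → Sequent A → Tree A → Tree A → Set
SymStep Γ P P' = PreProof P Γ × PreProof P' Γ × (Step Γ P P' ⊎ Step Γ P' P)

Equiv : {A : Set} → Sequent A → Tree A → Tree A → Set
Equiv Γ = Star (SymStep Γ)

{-# OPTIONS --safe #-}
-- Correctness means that every switching graph is a spanning tree, which we
-- phrase as: it connects all vertices and every edge is a bridge.  It suffices to show that
-- one rewriting step, in either direction, preserves correctness.  The switching graph of
-- P{T} is the fixed graph of the context and the sequent plus the local edges of T.  For a
-- step T₁ ⇝ T₂ and a switching s₂ of the result we choose a switching s₁ of the source and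
-- one kept local edge on each side such that, after renaming the nodes below the hole,
-- contracting these edges yields the same graph.  Contracting a non-loop edge preserves and
-- reflects being a spanning tree.  For the switch rule the side condition says exactly that
-- ⊥ᵢ may be moved from its ⊗-node to the root ⅋ without closing a cycle.  The inverse
-- directions of the two associativity steps follow from the forward ones by commutativity.
module Submission where

open import Data.Empty using (⊥; ⊥-elim)
open import Data.Fin using (Fin; zero; suc)
open import Data.List using (List; []; _∷_; _++_; map; length; lookup; reverse; take; drop; _∷ʳ_)
import Data.List.Properties as LP
open import Data.List.Membership.Propositional using (_∈_; _∉_)
open import Data.List.Membership.Propositional.Properties
  using (∈-map⁺; ∈-map⁻; ∈-++⁺ˡ; ∈-++⁺ʳ; ∈-++⁻; ∈-∃++; ∈-lookup)
open import Data.List.Relation.Binary.Permutation.Propositional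
  using (_↭_; ↭-refl; ↭-sym; ↭-trans; prep; swap; ↭-reflexive)
open import Data.List.Relation.Binary.Permutation.Propositional.Properties
  using (∈-resp-↭; shift; shifts; drop-∷; ↭-map-inv; map⁺; ++⁺ˡ; ++⁺ʳ; ++-comm)
open import Data.List.Relation.Binary.Subset.Propositional using (_⊆_)
open import Data.List.Relation.Binary.Subset.Propositional.Properties using (⊆-refl; ⊆-reflexive-↭)
open import Data.List.Relation.Unary.All as All using (All; []; _∷_)
open import Data.List.Relation.Unary.Any as Any using (here; there; index)
open import Data.List.Relation.Unary.Any.Properties using (lookup-index)
open import Data.List.Relation.Unary.AllPairs using ([]; _∷_)
open import Data.List.Relation.Unary.Unique.Propositional using (Unique)
import Data.List.Relation.Unary.Unique.Propositional.Properties as UP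
open import Data.Maybe using (Maybe; just; nothing)
open import Data.Nat as N using (ℕ; zero; suc; _∸_; _+_)
import Data.Nat.Properties as NP
open import Data.Product using (Σ; ∃; ∃₂; _×_; _,_; proj₁; proj₂)
open import Data.Product.Properties using (,-injectiveˡ; ,-injectiveʳ)
open import Data.Sum as Sum using (_⊎_; inj₁; inj₂)
open import Function using (id; _∘_)
open import Relation.Binary.Construct.Closure.ReflexiveTransitive as Star using (Star; ε; _◅_; _◅◅_)
open import Relation.Binary.PropositionalEquality using (_≡_; _≢_; refl; sym; trans; cong; cong₂; subst; subst₂)
open import Relation.Nullary using (¬_; Dec; yes; no)

open import Defs

dir-≟ : (a b : Dir) → Dec (a ≡ b)
dir-≟ l l = yes refl
dir-≟ l r = no (λ ())
dir-≟ r l = no (λ ())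
dir-≟ r r = yes refl

path-≟ : (a b : Path) → Dec (a ≡ b)
path-≟ = LP.≡-dec dir-≟

vertex-≟ : (u v : Vertex) → Dec (u ≡ v)
vertex-≟ (leafV i) (leafV j) with i N.≟ j
... | yes refl = yes refl
... | no ne = no (λ { refl → ne refl })
vertex-≟ (leafV _) (nodeP _) = no (λ ())
vertex-≟ (leafV _) (nodeΓ _ _) = no (λ ())
vertex-≟ (nodeP _) (leafV _) = no (λ ())
vertex-≟ (nodeP p) (nodeP q) with path-≟ p q
... | yes refl = yes refl
... | no ne = no (λ { refl → ne refl })
vertex-≟ (nodeP _) (nodeΓ _ _) = no (λ ())
vertex-≟ (nodeΓ _ _) (leafV _) = no (λ ())
vertex-≟ (nodeΓ _ _) (nodeP _) = no (λ ())
vertex-≟ (nodeΓ k p) (nodeΓ k' q) with k N.≟ k' | path-≟ p q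
... | yes refl | yes refl = yes refl
... | no ne | _ = no (λ { refl → ne refl })
... | yes _ | no ne = no (λ { refl → ne refl })

-- Reachability and spanning trees

Adjacent : List Edge → Vertex → Vertex → Set
Adjacent E u w = (u , w) ∈ E ⊎ (w , u) ∈ E

Reach : List Edge → Vertex → Vertex → Set
Reach E = Star (Adjacent E)

adjacent-sym : ∀ {E u w} → Adjacent E u w → Adjacent E w u
adjacent-sym (inj₁ x) = inj₂ x
adjacent-sym (inj₂ y) = inj₁ y

reach-sym : ∀ {E u v} → Reach E u v → Reach E v u
reach-sym = Star.reverse adjacent-sym

along : ∀ {E u w} → (u , w) ∈ E → Reach E u w
along m = inj₁ m ◅ ε

against : ∀ {E u w} → (w , u) ∈ E → Reach E u w
against m = inj₂ m ◅ ε

reach-via : ∀ {E E'} → (∀ {a b} → (a , b) ∈ E → Reach E' a b) → ∀ {u v} → Reach E u v → Reach E' u v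
reach-via h = Star.kleisliStar id λ { (inj₁ m) → h m ; (inj₂ m) → reach-sym (h m) }

reach-mono : ∀ {E E'} → E ⊆ E' → ∀ {u v} → Reach E u v → Reach E' u v
reach-mono h = Star.map (Sum.map h h)

reach-↭ : ∀ {E E'} → E ↭ E' → ∀ {u v} → Reach E u v → Reach E' u v
reach-↭ p = reach-mono (∈-resp-↭ p)

reach-split : ∀ {a b E x y} → Reach ((a , b) ∷ E) x y →
  Reach E x y ⊎ ((Reach E x a × Reach E b y) ⊎ (Reach E x b × Reach E a y))
reach-split ε = inj₁ ε
reach-split (inj₁ (there m) ◅ p) with reach-split p
... | inj₁ q = inj₁ (inj₁ m ◅ q)
... | inj₂ (inj₁ (q , q')) = inj₂ (inj₁ ((inj₁ m ◅ q) , q'))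
... | inj₂ (inj₂ (q , q')) = inj₂ (inj₂ ((inj₁ m ◅ q) , q'))
reach-split (inj₂ (there m) ◅ p) with reach-split p
... | inj₁ q = inj₁ (inj₂ m ◅ q)
... | inj₂ (inj₁ (q , q')) = inj₂ (inj₁ ((inj₂ m ◅ q) , q'))
reach-split (inj₂ (there m) ◅ p) | inj₂ (inj₂ (q , q')) = inj₂ (inj₂ ((inj₂ m ◅ q) , q'))
reach-split (inj₁ (here refl) ◅ p) with reach-split p
... | inj₁ q = inj₂ (inj₁ (ε , q))
... | inj₂ (inj₁ (q , q')) = inj₂ (inj₁ (ε , q'))
... | inj₂ (inj₂ (q , q')) = inj₁ q'
reach-split (inj₂ (here refl) ◅ p) with reach-split p
... | inj₁ q = inj₂ (inj₂ (ε , q))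
... | inj₂ (inj₁ (q , q')) = inj₁ q'
... | inj₂ (inj₂ (q , q')) = inj₂ (inj₂ (ε , q'))

mapEdge : (Vertex → Vertex) → Edge → Edge
mapEdge f (a , b) = f a , f b

mapEdges : (Vertex → Vertex) → List Edge → List Edge
mapEdges f = map (mapEdge f)

reach-map : ∀ f {E x y} → Reach E x y → Reach (mapEdges f E) (f x) (f y)
reach-map f = Star.gmap f (Sum.map (∈-map⁺ (mapEdge f)) (∈-map⁺ (mapEdge f)))

reach-collapse : ∀ f K E → (∀ {a b} → (a , b) ∈ K → f a ≡ f b) →
  ∀ {x y} → Reach (K ++ E) x y → Reach (mapEdges f E) (f x) (f y)
reach-collapse f K E h ε = ε
reach-collapse f K E h {y = y} (inj₁ m ◅ p) with ∈-++⁻ K m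
... | inj₁ mk = subst (λ z → Reach (mapEdges f E) z (f y)) (sym (h mk)) (reach-collapse f K E h p)
... | inj₂ me = inj₁ (∈-map⁺ (mapEdge f) me) ◅ reach-collapse f K E h p
reach-collapse f K E h {y = y} (inj₂ m ◅ p) with ∈-++⁻ K m
... | inj₁ mk = subst (λ z → Reach (mapEdges f E) z (f y)) (h mk) (reach-collapse f K E h p)
... | inj₂ me = inj₂ (∈-map⁺ (mapEdge f) me) ◅ reach-collapse f K E h p

reach-++ˡ : ∀ {K E x y} → Reach K x y → Reach (K ++ E) x y
reach-++ˡ = reach-mono ∈-++⁺ˡ

reach-lift : ∀ f K E → (∀ x y → f x ≡ f y → Reach K x y) →
  ∀ {a b} → Reach (mapEdges f E) a b → ∀ x y → f x ≡ a → f y ≡ b → Reach (K ++ E) x y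
reach-lift f K E fib ε x y ex ey = reach-++ˡ (fib x y (trans ex (sym ey)))
reach-lift f K E fib (inj₁ m ◅ p) x y ex ey with ∈-map⁻ (mapEdge f) m
... | (c , d) , mcd , eq with ,-injectiveˡ eq | ,-injectiveʳ eq
... | e1 | e2 = reach-++ˡ (fib x c (trans ex e1)) ◅◅
                  (inj₁ (∈-++⁺ʳ K mcd) ◅ reach-lift f K E fib p d y (sym e2) ey)
reach-lift f K E fib (inj₂ m ◅ p) x y ex ey with ∈-map⁻ (mapEdge f) m
... | (c , d) , mcd , eq with ,-injectiveˡ eq | ,-injectiveʳ eq
... | e1 | e2 = reach-++ˡ (fib x d (trans ex e2)) ◅◅
                  (inj₂ (∈-++⁺ʳ K mcd) ◅ reach-lift f K E fib p c y (sym e1) ey)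

Connects : List Edge → List Vertex → Set
Connects E V = ∀ {u v} → u ∈ V → v ∈ V → Reach E u v

AllBridges : List Edge → Set
AllBridges E = ∀ c d F → E ↭ (c , d) ∷ F → ¬ Reach F c d

SpanningTree : List Edge → List Vertex → Set
SpanningTree E V = Connects E V × AllBridges E

spanningTree-resp : ∀ {E E' V V'} → E ↭ E' → V' ⊆ V → SpanningTree E V → SpanningTree E' V'
spanningTree-resp p vs (cn , br) = (λ u v → reach-↭ p (cn (vs u) (vs v))) ,
  (λ c d F q r → br c d F (↭-trans p q) r)

spanningTree-↭ : ∀ {E E' V} → E ↭ E' → SpanningTree E V → SpanningTree E' V
spanningTree-↭ p = spanningTree-resp p ⊆-refl

head-bridge : ∀ {c d F V} → SpanningTree ((c , d) ∷ F) V → ¬ Reach F c d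
head-bridge (_ , br) = br _ _ _ ↭-refl

∈⇒↭∷ : ∀ {A : Set} {e : A} {E} → e ∈ E → ∃ λ G → E ↭ e ∷ G
∈⇒↭∷ {e = e} m with ∈-∃++ m
... | A1 , A2 , refl = (A1 ++ A2) , shift e A1 A2

∈-↭∷-≢ : ∀ {A : Set} {x y : A} {E G} → x ∈ E → E ↭ y ∷ G → x ≢ y → x ∈ G
∈-↭∷-≢ m p ne with ∈-resp-↭ p m
... | here eq = ⊥-elim (ne eq)
... | there m' = m'

∷-↭-∷ : ∀ {A : Set} {x y : A} {P Q} → x ∷ P ↭ y ∷ Q →
  (x ≡ y × P ↭ Q) ⊎ (∃ λ C → P ↭ y ∷ C × Q ↭ x ∷ C)
∷-↭-∷ {x = x} {y} {P} {Q} p with ∈-resp-↭ (↭-sym p) (here refl)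
... | here refl = inj₁ (refl , drop-∷ p)
... | there m with ∈⇒↭∷ m
... | C , q = inj₂ (C , q , drop-∷ (↭-trans (↭-sym p) (↭-trans (prep x q) (swap x y ↭-refl))))

contract-spanningTree : ∀ f K E V V' →
  (∀ {a b} → (a , b) ∈ K → f a ≡ f b) →
  (∀ x y → f x ≡ f y → Reach K x y) →
  V' ⊆ map f V →
  SpanningTree (K ++ E) V → SpanningTree (mapEdges f E) V'
contract-spanningTree f K E V V' col fib vs (cn , br) = connects , bridges
  where
  connects : Connects (mapEdges f E) V'
  connects mu mv with ∈-map⁻ f (vs mu) | ∈-map⁻ f (vs mv)
  ... | u0 , mu0 , refl | v0 , mv0 , refl = reach-collapse f K E col (cn mu0 mv0)
  bridges : AllBridges (mapEdges f E)
  bridges c' d' F' p rr with ↭-map-inv (mapEdge f) p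
  ... | [] , () , _
  ... | (c , d) ∷ F0 , eq , q with LP.∷-injective eq
  ... | e1 , refl with ,-injectiveˡ e1 | ,-injectiveʳ e1
  ... | refl | refl = br c d (K ++ F0) (↭-trans (++⁺ˡ K q) (shift (c , d) K F0))
                        (reach-lift f K F0 fib rr c d refl refl)

data ReachAvoiding (w : Vertex) (E : List Edge) : Vertex → Vertex → Set where
  stay : ∀ {u} → ReachAvoiding w E u u
  move : ∀ {u x v} → Adjacent E u x → u ≢ w → x ≢ w → ReachAvoiding w E x v → ReachAvoiding w E u v

last-edge : ∀ {E a w} → Reach E a w → a ≢ w → ∃ λ z → Adjacent E z w × ReachAvoiding w E a z
last-edge ε ne = ⊥-elim (ne refl)
last-edge {w = w} (_◅_ {u} {x} adj p) ne with vertex-≟ x w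
... | yes refl = u , adj , stay
... | no nx with last-edge p nx
... | z , az , ra = z , az , move adj ne nx ra

avoiding⇒reach : ∀ {w E G} → (∀ {a b} → (a , b) ∈ E → a ≢ w → b ≢ w → (a , b) ∈ G) →
  ∀ {x y} → ReachAvoiding w E x y → Reach G x y
avoiding⇒reach h stay = ε
avoiding⇒reach h (move (inj₁ m) nu nx ra) = inj₁ (h m nu nx) ◅ avoiding⇒reach h ra
avoiding⇒reach h (move (inj₂ m) nu nx ra) = inj₂ (h m nx nu) ◅ avoiding⇒reach h ra

expand-spanningTree : ∀ f u w E V V' → u ≢ w → f u ≡ f w →
  (∀ x y → f x ≡ f y → Reach ((u , w) ∷ []) x y) →
  (∀ {v} → v ∈ V → f v ∈ V') →
  SpanningTree (mapEdges f E) V' → SpanningTree ((u , w) ∷ E) V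
expand-spanningTree f u w E V V' nuw fuw fib vs (cn , br) = connects , bridges
  where
  connects : Connects ((u , w) ∷ E) V
  connects {x} {y} mx my = reach-lift f ((u , w) ∷ []) E fib (cn (vs mx) (vs my)) x y refl refl
  col : ∀ {a b} → (a , b) ∈ (u , w) ∷ [] → f a ≡ f b
  col (here refl) = fuw
  bridges : AllBridges ((u , w) ∷ E)
  bridges c d F p rr with ∷-↭-∷ p
  ... | inj₂ (C , q1 , q2) =
        br (f c) (f d) (mapEdges f C) (map⁺ (mapEdge f) q1)
           (reach-collapse f ((u , w) ∷ []) C col (reach-↭ q2 rr))
  ... | inj₁ (refl , q) with last-edge (reach-↭ (↭-sym q) rr) nuw
  ... | z , inj₁ mz , ra with ∈⇒↭∷ mz
  ...   | G , pg = br (f z) (f w) (mapEdges f G) (map⁺ (mapEdge f) pg)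
                     (subst (Reach (mapEdges f G) (f z)) fuw (reach-sym (reach-map f (avoiding⇒reach h ra))))
    where
    h : ∀ {a b} → (a , b) ∈ E → a ≢ w → b ≢ w → (a , b) ∈ G
    h m _ nb = ∈-↭∷-≢ m pg (λ eq → nb (,-injectiveʳ eq))
  bridges c d F p rr | inj₁ (refl , q) | z , inj₂ mz , ra with ∈⇒↭∷ mz
  ...   | G , pg = br (f w) (f z) (mapEdges f G) (map⁺ (mapEdge f) pg)
                     (subst (λ t → Reach (mapEdges f G) t (f z)) fuw (reach-map f (avoiding⇒reach h ra)))
    where
    h : ∀ {a b} → (a , b) ∈ E → a ≢ w → b ≢ w → (a , b) ∈ G
    h m na _ = ∈-↭∷-≢ m pg (λ eq → na (,-injectiveˡ eq))

exchange-edge : ∀ a b a' b' E V → a' ∈ V → b' ∈ V → ¬ Reach E a' b' →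
  SpanningTree ((a , b) ∷ E) V → SpanningTree ((a' , b') ∷ E) V
exchange-edge a b a' b' E V ma' mb' nr (cn , br) = connects , bridges
  where
  E' = (a' , b') ∷ E
  weaken : ∀ {x y} → Reach E x y → Reach E' x y
  weaken = reach-mono there
  ab-reachable : Reach E' a b
  ab-reachable with reach-split (cn ma' mb')
  ... | inj₁ q = ⊥-elim (nr q)
  ... | inj₂ (inj₁ (q1 , q2)) = weaken (reach-sym q1) ◅◅ (along (here refl) ◅◅ weaken (reach-sym q2))
  ... | inj₂ (inj₂ (q1 , q2)) = weaken q2 ◅◅ (against (here refl) ◅◅ weaken q1)
  old-edges-reachable : ∀ {x y} → (x , y) ∈ (a , b) ∷ E → Reach E' x y
  old-edges-reachable (here refl) = ab-reachable
  old-edges-reachable (there m) = along (there m)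
  connects : Connects E' V
  connects mu mv = reach-via old-edges-reachable (cn mu mv)
  bridges : AllBridges E'
  bridges c d F p rr with ∷-↭-∷ p
  ... | inj₁ (refl , q) = nr (reach-↭ (↭-sym q) rr)
  ... | inj₂ (C , q1 , q2) with reach-split (reach-↭ q2 rr)
  ...   | inj₁ s = br c d ((a , b) ∷ C) (↭-trans (prep (a , b) q1) (swap (a , b) (c , d) ↭-refl))
      (reach-mono there s)
  ...   | inj₂ (inj₁ (s1 , s2)) = nr (reach-↭ (↭-sym q1) (reach-mono there (reach-sym s1)) ◅◅
                                 (along (∈-resp-↭ (↭-sym q1) (here refl)) ◅◅
                                     reach-↭ (↭-sym q1) (reach-mono there (reach-sym s2))))
  ...   | inj₂ (inj₂ (s1 , s2)) = nr (reach-↭ (↭-sym q1) (reach-mono there s2) ◅◅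
                                 (against (∈-resp-↭ (↭-sym q1) (here refl)) ◅◅
                                     reach-↭ (↭-sym q1) (reach-mono there s1)))

siblings-separated : ∀ x c q r0 H V → SpanningTree ((x , c) ∷ (q , c) ∷ H) V →
  SpanningTree ((x , c) ∷ (r0 , c) ∷ H) V →
  ¬ Reach ((q , c) ∷ H) x r0
siblings-separated x c q r0 H V A B rr with reach-split rr
... | inj₁ s = head-bridge B (reach-mono there s ◅◅ along (here refl))
... | inj₂ (inj₁ (s1 , s2)) = head-bridge A (reach-mono there s1 ◅◅ along (here refl))
... | inj₂ (inj₂ (s1 , s2)) = head-bridge B (reach-mono there s1)

-- Trails

Joins : (E : List Edge) → Fin (length E) → Vertex → Vertex → Set
Joins E e u w = lookup E e ≡ (u , w) ⊎ lookup E e ≡ (w , u)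

trail⇒reach : ∀ {E u v es} → Trail E u v es → Reach E u v
trail⇒reach nil = ε
trail⇒reach {E} (step e (inj₁ eq) t) = inj₁ (subst (_∈ E) eq (∈-lookup e)) ◅ trail⇒reach t
trail⇒reach {E} (step e (inj₂ eq) t) = inj₂ (subst (_∈ E) eq (∈-lookup e)) ◅ trail⇒reach t

adjacent⇒joins : ∀ {E u w} → Adjacent E u w → Σ (Fin (length E)) λ e → Joins E e u w
adjacent⇒joins (inj₁ m) = index m , inj₁ (sym (lookup-index m))
adjacent⇒joins (inj₂ m) = index m , inj₂ (sym (lookup-index m))

reach⇒trail : ∀ {E u v} → Reach E u v → ∃ λ es → Trail E u v es
reach⇒trail ε = [] , nil
reach⇒trail (a ◅ p) with adjacent⇒joins a | reach⇒trail p
... | e , lk | es , t = e ∷ es , step e lk t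

data SimpleTrail (E : List Edge) : Vertex → Vertex → List Vertex → List (Fin (length E)) → Set where
  done : ∀ {u} → SimpleTrail E u u (u ∷ []) []
  next : ∀ {u w v vs es} (e : Fin (length E)) → Joins E e u w → SimpleTrail E w v vs es → u ∉ vs →
          SimpleTrail E u v (u ∷ vs) (e ∷ es)

simpleTrail-head : ∀ {E u v vs es} → SimpleTrail E u v vs es → u ∈ vs
simpleTrail-head done = here refl
simpleTrail-head (next _ _ _ _) = here refl

simpleTrail-ends : ∀ {E u v vs es e} → SimpleTrail E u v vs es → e ∈ es →
  ∃₂ λ x y → x ∈ vs × y ∈ vs × lookup E e ≡ (x , y)
simpleTrail-ends (next {u} {w} e (inj₁ eq) t nu) (here refl) = u , w , here refl , there (simpleTrail-head t) , eq
simpleTrail-ends (next {u} {w} e (inj₂ eq) t nu) (here refl) = w , u , there (simpleTrail-head t) , here refl , eq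
simpleTrail-ends (next e _ t nu) (there m) with simpleTrail-ends t m
... | x , y , mx , my , eq = x , y , there mx , there my , eq

fresh-edge : ∀ {E u w vs} {e : Fin (length E)} {x y} → Joins E e u w → u ∉ vs →
  x ∈ vs → y ∈ vs → lookup E e ≡ (x , y) → ⊥
fresh-edge (inj₁ eq') nu mx my eq = nu (subst (_∈ _) (,-injectiveˡ (trans (sym eq) eq')) mx)
fresh-edge (inj₂ eq') nu mx my eq = nu (subst (_∈ _) (,-injectiveʳ (trans (sym eq) eq')) my)

simpleTrail-unique : ∀ {E u v vs es} → SimpleTrail E u v vs es → Unique es
simpleTrail-unique done = []
simpleTrail-unique {E} (next {u} e lk t nu) = All.tabulate h ∷ simpleTrail-unique t
  where
  h : ∀ {e'} → e' ∈ _ → e ≢ e'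
  h m refl with simpleTrail-ends t m
  ... | x , y , mx , my , eq = fresh-edge {E} {e = e} lk nu mx my eq

simpleTrail⇒trail : ∀ {E u v vs es} → SimpleTrail E u v vs es → Trail E u v es
simpleTrail⇒trail done = nil
simpleTrail⇒trail (next e lk t _) = step e lk (simpleTrail⇒trail t)

simpleTrail-from : ∀ {E w v vs es u} → SimpleTrail E w v vs es → u ∈ vs → ∃₂ λ vs' es' → SimpleTrail E u v vs' es'
simpleTrail-from done (here refl) = _ , _ , done
simpleTrail-from (next e lk t nu) (here refl) = _ , _ , next e lk t nu
simpleTrail-from (next e lk t nu) (there m) = simpleTrail-from t m

reach⇒simpleTrail : ∀ {E u v} → Reach E u v → ∃₂ λ vs es → SimpleTrail E u v vs es
reach⇒simpleTrail ε = _ , _ , done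
reach⇒simpleTrail {u = u} (a ◅ p) with reach⇒simpleTrail p
... | vs , es , t with Any.any? (vertex-≟ u) vs
...   | yes m = simpleTrail-from t m
...   | no nm with adjacent⇒joins a
...     | e , lk = _ , _ , next e lk t nm

reach⇒uniqueTrail : ∀ {E u v} → Reach E u v → ∃ λ es → Trail E u v es × Unique es
reach⇒uniqueTrail p with reach⇒simpleTrail p
... | vs , es , t = es , simpleTrail⇒trail t , simpleTrail-unique t

connected⇒connects : ∀ {E V} → Connected E V → Connects E V
connected⇒connects c mu mv = trail⇒reach (proj₂ (c mu mv))

connects⇒connected : ∀ {E V} → Connects E V → Connected E V
connects⇒connected c mu mv = reach⇒trail (c mu mv)

remove-at : ∀ (E : List Edge) (e : Fin (length E)) → ∃ λ G → E ↭ lookup E e ∷ G ×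
  (∀ e' → e' ≢ e → lookup E e' ∈ G)
remove-at (x ∷ E) zero = E , ↭-refl , h
  where
  h : ∀ e' → e' ≢ zero → lookup (x ∷ E) e' ∈ E
  h zero ne = ⊥-elim (ne refl)
  h (suc e') ne = ∈-lookup e'
remove-at (x ∷ E) (suc k) with remove-at E k
... | G , p , h = x ∷ G , ↭-trans (prep x p) (swap x _ ↭-refl) , h'
  where
  h' : ∀ e' → e' ≢ suc k → lookup (x ∷ E) e' ∈ x ∷ G
  h' zero ne = here refl
  h' (suc e') ne = there (h e' (λ eq → ne (cong suc eq)))

trail-avoiding : ∀ {E G u v es e} → (∀ e' → e' ≢ e → lookup E e' ∈ G) → Trail E u v es →
  All (e ≢_) es → Reach G u v
trail-avoiding h nil _ = ε
trail-avoiding h (step e' (inj₁ eq) t) (ne ∷ a) =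
  inj₁ (subst (_∈ _) eq (h e' (λ q → ne (sym q)))) ◅ trail-avoiding h t a
trail-avoiding h (step e' (inj₂ eq) t) (ne ∷ a) =
  inj₂ (subst (_∈ _) eq (h e' (λ q → ne (sym q)))) ◅ trail-avoiding h t a

allBridges⇒acyclic : ∀ {E} → AllBridges E → Acyclic E
allBridges⇒acyclic {E} br (u , e , es , step {w = w} .e lk t , (hd ∷ _)) with remove-at E e
... | G , p , h with lk
...   | inj₁ eq = br u w G (subst (λ z → E ↭ z ∷ G) eq p) (reach-sym (trail-avoiding h t hd))
...   | inj₂ eq = br w u G (subst (λ z → E ↭ z ∷ G) eq p) (trail-avoiding h t hd)

skip : ∀ {y : Edge} (E1 : List Edge) {E2} → Fin (length (E1 ++ E2)) → Fin (length (E1 ++ y ∷ E2))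
skip [] j = suc j
skip (x ∷ E1) zero = zero
skip (x ∷ E1) (suc j) = suc (skip E1 j)

skipped : ∀ {y : Edge} (E1 : List Edge) {E2} → Fin (length (E1 ++ y ∷ E2))
skipped [] = zero
skipped (x ∷ E1) = suc (skipped E1)

lookup-skip : ∀ {y} E1 {E2} j → lookup (E1 ++ y ∷ E2) (skip E1 j) ≡ lookup (E1 ++ E2) j
lookup-skip [] j = refl
lookup-skip (x ∷ E1) zero = refl
lookup-skip (x ∷ E1) (suc j) = lookup-skip E1 j

lookup-skipped : ∀ {y} E1 {E2} → lookup (E1 ++ y ∷ E2) (skipped E1) ≡ y
lookup-skipped [] = refl
lookup-skipped (x ∷ E1) = lookup-skipped E1

suc-inj : ∀ {n} {a b : Fin n} → suc a ≡ suc b → a ≡ b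
suc-inj refl = refl

skip-injective : ∀ {y} E1 {E2} {i j} → skip {y} E1 {E2} i ≡ skip E1 j → i ≡ j
skip-injective [] eq = suc-inj eq
skip-injective (x ∷ E1) {i = zero} {zero} eq = refl
skip-injective (x ∷ E1) {i = zero} {suc j} ()
skip-injective (x ∷ E1) {i = suc i} {zero} ()
skip-injective (x ∷ E1) {i = suc i} {suc j} eq = cong suc (skip-injective E1 (suc-inj eq))

skipped≢skip : ∀ {y} E1 {E2} j → skipped {y} E1 {E2} ≢ skip E1 j
skipped≢skip [] j ()
skipped≢skip (x ∷ E1) zero ()
skipped≢skip (x ∷ E1) (suc j) eq = skipped≢skip E1 j (suc-inj eq)

trail-skip : ∀ {y} E1 {E2 u v es} → Trail (E1 ++ E2) u v es → Trail (E1 ++ y ∷ E2) u v (map (skip E1) es)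
trail-skip E1 nil = nil
trail-skip E1 (step e (inj₁ eq) t) = step (skip E1 e) (inj₁ (trans (lookup-skip E1 e) eq)) (trail-skip E1 t)
trail-skip E1 (step e (inj₂ eq) t) = step (skip E1 e) (inj₂ (trans (lookup-skip E1 e) eq)) (trail-skip E1 t)

skipped∉skips : ∀ {y} E1 {E2} (es : List (Fin (length (E1 ++ E2)))) →
  All (skipped {y} E1 {E2} ≢_) (map (skip E1) es)
skipped∉skips E1 [] = []
skipped∉skips E1 (j ∷ es) = skipped≢skip E1 j ∷ skipped∉skips E1 es

acyclic⇒allBridges : ∀ {E} → Acyclic E → AllBridges E
acyclic⇒allBridges {E} ac c d F p rr with ∈-∃++ (∈-resp-↭ (↭-sym p) (here refl))
... | E1 , E2 , refl with reach⇒uniqueTrail (reach-↭ (↭-sym (drop-∷ (↭-trans (↭-sym (shift (c , d) E1 E2)) p))) rr)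
... | es , t , u =
  ac (d , skipped E1 , map (skip E1) es ,
      step (skipped E1) (inj₂ (lookup-skipped E1)) (trail-skip E1 t) ,
      (skipped∉skips E1 es ∷ UP.map⁺ (skip-injective E1) u))

connectedAcyclic⇒spanningTree : ∀ {E V} → Connected E V × Acyclic E → SpanningTree E V
connectedAcyclic⇒spanningTree (c , a) = connected⇒connects c , acyclic⇒allBridges a

spanningTree⇒connectedAcyclic : ∀ {E V} → SpanningTree E V → Connected E V × Acyclic E
spanningTree⇒connectedAcyclic (c , b) = connects⇒connected c , allBridges⇒acyclic b

-- Switching graphs of plugged linkings

FixesLeaves : (Vertex → Vertex) → Set
FixesLeaves f = ∀ i → f (leafV i) ≡ leafV i

at : (Path → Vertex) → Path → Path → Vertex
at mk q y = mk (y ++ q)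

pick : Dir → List Edge → List Edge → List Edge
pick l a b = a
pick r a b = b

treeEdges-⅋ : ∀ {A} x mk s (t u : Tree A) p → treeEdges x mk s (t ⅋ u) p ≡
  pick (s (mk p)) (childEdge x mk u (r ∷ p) (mk p)) (childEdge x mk t (l ∷ p) (mk p))
  ++ treeEdges x mk s t (l ∷ p) ++ treeEdges x mk s u (r ∷ p)
treeEdges-⅋ x mk s t u p with s (mk p)
... | l = refl
... | r = refl

mapEdges-++ : ∀ f A B → mapEdges f (A ++ B) ≡ mapEdges f A ++ mapEdges f B
mapEdges-++ f A B = LP.map-++ (mapEdge f) A B

mapEdges-pick : ∀ f d A B → mapEdges f (pick d A B) ≡ pick d (mapEdges f A) (mapEdges f B)
mapEdges-pick f l A B = refl
mapEdges-pick f r A B = refl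

rootV-rename : ∀ {A} mk1 mk2 f (T : Tree A) q1 q2 → f (mk1 q1) ≡ mk2 q2 → FixesLeaves f →
  f (rootV mk1 T q1) ≡ rootV mk2 T q2
rootV-rename mk1 mk2 f (leaf (_ , i)) q1 q2 h lf = lf i
rootV-rename mk1 mk2 f (_ ⊗ _) q1 q2 h lf = h
rootV-rename mk1 mk2 f (_ ⅋ _) q1 q2 h lf = h

childEdge-rename : ∀ {A} x mk1 mk2 f (T : Tree A) q1 q2 v → f (mk1 q1) ≡ mk2 q2 → FixesLeaves f →
  mapEdges f (childEdge x mk1 T q1 v) ≡ childEdge x mk2 T q2 (f v)
childEdge-rename nothing mk1 mk2 f T q1 q2 v h lf =
    cong (λ z → (z , f v) ∷ []) (rootV-rename mk1 mk2 f T q1 q2 h lf)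
childEdge-rename (just i) mk1 mk2 f (leaf (_ , j)) q1 q2 v h lf with i N.≟ j
... | yes _ = refl
... | no _ = cong (λ z → (z , f v) ∷ []) (lf j)
childEdge-rename (just i) mk1 mk2 f (_ ⊗ _) q1 q2 v h lf = cong (λ z → (z , f v) ∷ []) h
childEdge-rename (just i) mk1 mk2 f (_ ⅋ _) q1 q2 v h lf = cong (λ z → (z , f v) ∷ []) h

treeEdges-rename : ∀ {A} x mk1 mk2 s1 s2 f (T : Tree A) q →
  (∀ y → f (mk1 y) ≡ mk2 y) → (∀ y → s1 (mk1 y) ≡ s2 (mk2 y)) → FixesLeaves f →
  mapEdges f (treeEdges x mk1 s1 T q) ≡ treeEdges x mk2 s2 T q
treeEdges-rename x mk1 mk2 s1 s2 f (leaf _) q hf hs lf = refl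
treeEdges-rename x mk1 mk2 s1 s2 f (t ⊗ u) q hf hs lf
  rewrite mapEdges-++ f (childEdge x mk1 t (l ∷ q) (mk1 q)) (childEdge x mk1 u (r ∷ q) (mk1 q)
              ++ treeEdges x mk1 s1 t (l ∷ q) ++ treeEdges x mk1 s1 u (r ∷ q))
        | mapEdges-++ f (childEdge x mk1 u (r ∷ q) (mk1 q))
            (treeEdges x mk1 s1 t (l ∷ q) ++ treeEdges x mk1 s1 u (r ∷ q))
        | mapEdges-++ f (treeEdges x mk1 s1 t (l ∷ q)) (treeEdges x mk1 s1 u (r ∷ q))
        | childEdge-rename x mk1 mk2 f t (l ∷ q) (l ∷ q) (mk1 q) (hf (l ∷ q)) lf
        | childEdge-rename x mk1 mk2 f u (r ∷ q) (r ∷ q) (mk1 q) (hf (r ∷ q)) lf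
        | hf q
        | treeEdges-rename x mk1 mk2 s1 s2 f t (l ∷ q) hf hs lf
        | treeEdges-rename x mk1 mk2 s1 s2 f u (r ∷ q) hf hs lf = refl
treeEdges-rename x mk1 mk2 s1 s2 f (t ⅋ u) q hf hs lf
  rewrite treeEdges-⅋ x mk1 s1 t u q | treeEdges-⅋ x mk2 s2 t u q
        | mapEdges-++ f (pick (s1 (mk1 q)) (childEdge x mk1 u (r ∷ q) (mk1 q)) (childEdge x mk1 t (l ∷ q) (mk1 q)))
                    (treeEdges x mk1 s1 t (l ∷ q) ++ treeEdges x mk1 s1 u (r ∷ q))
        | mapEdges-++ f (treeEdges x mk1 s1 t (l ∷ q)) (treeEdges x mk1 s1 u (r ∷ q))
        | mapEdges-pick f (s1 (mk1 q)) (childEdge x mk1 u (r ∷ q) (mk1 q)) (childEdge x mk1 t (l ∷ q) (mk1 q))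
        | childEdge-rename x mk1 mk2 f t (l ∷ q) (l ∷ q) (mk1 q) (hf (l ∷ q)) lf
        | childEdge-rename x mk1 mk2 f u (r ∷ q) (r ∷ q) (mk1 q) (hf (r ∷ q)) lf
        | hf q | hs q
        | treeEdges-rename x mk1 mk2 s1 s2 f t (l ∷ q) hf hs lf
        | treeEdges-rename x mk1 mk2 s1 s2 f u (r ∷ q) hf hs lf = refl

treeVerts-rename : ∀ {A} mk1 mk2 f (T : Tree A) q → (∀ y → f (mk1 y) ≡ mk2 y) → FixesLeaves f →
  map f (treeVerts mk1 T q) ≡ treeVerts mk2 T q
treeVerts-rename mk1 mk2 f (leaf (_ , i)) q hf lf = cong (_∷ []) (lf i)
treeVerts-rename mk1 mk2 f (t ⊗ u) q hf lf rewrite LP.map-++ f (treeVerts mk1 t (l ∷ q)) (treeVerts mk1 u (r ∷ q))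
  | hf q | treeVerts-rename mk1 mk2 f t (l ∷ q) hf lf | treeVerts-rename mk1 mk2 f u (r ∷ q) hf lf = refl
treeVerts-rename mk1 mk2 f (t ⅋ u) q hf lf rewrite LP.map-++ f (treeVerts mk1 t (l ∷ q)) (treeVerts mk1 u (r ∷ q))
  | hf q | treeVerts-rename mk1 mk2 f t (l ∷ q) hf lf | treeVerts-rename mk1 mk2 f u (r ∷ q) hf lf = refl

rootV-shift : ∀ {A} mk (T : Tree A) z q → rootV mk T (z ++ q) ≡ rootV (at mk q) T z
rootV-shift mk (leaf x) z q = refl
rootV-shift mk (_ ⊗ _) z q = refl
rootV-shift mk (_ ⅋ _) z q = refl

childEdge-shift : ∀ {A} x mk (T : Tree A) z q v → childEdge x mk T (z ++ q) v ≡ childEdge x (at mk q) T z v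
childEdge-shift nothing mk T z q v = cong (λ w → (w , v) ∷ []) (rootV-shift mk T z q)
childEdge-shift (just i) mk (leaf (_ , j)) z q v with i N.≟ j
... | yes _ = refl
... | no _ = refl
childEdge-shift (just i) mk (_ ⊗ _) z q v = refl
childEdge-shift (just i) mk (_ ⅋ _) z q v = refl

treeEdges-shift : ∀ {A} x mk s (T : Tree A) z q → treeEdges x mk s T (z ++ q) ≡ treeEdges x (at mk q) s T z
treeEdges-shift x mk s (leaf _) z q = refl
treeEdges-shift x mk s (t ⊗ u) z q rewrite childEdge-shift x mk t (l ∷ z) q (mk (z ++ q)) | childEdge-shift x mk u
    (r ∷ z) q (mk (z ++ q))
  | treeEdges-shift x mk s t (l ∷ z) q | treeEdges-shift x mk s u (r ∷ z) q = refl
treeEdges-shift x mk s (t ⅋ u) z q rewrite treeEdges-⅋ x mk s t u (z ++ q) | treeEdges-⅋ x (at mk q) s t u z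
  | childEdge-shift x mk t (l ∷ z) q (mk (z ++ q)) | childEdge-shift x mk u (r ∷ z) q (mk (z ++ q))
  | treeEdges-shift x mk s t (l ∷ z) q | treeEdges-shift x mk s u (r ∷ z) q = refl

treeVerts-shift : ∀ {A} mk (T : Tree A) z q → treeVerts mk T (z ++ q) ≡ treeVerts (at mk q) T z
treeVerts-shift mk (leaf x) z q = refl
treeVerts-shift mk (t ⊗ u) z q rewrite treeVerts-shift mk t (l ∷ z) q | treeVerts-shift mk u (r ∷ z) q = refl
treeVerts-shift mk (t ⅋ u) z q rewrite treeVerts-shift mk t (l ∷ z) q | treeVerts-shift mk u (r ∷ z) q = refl

treeEdges-move : ∀ {A} x s1 s2 f (T : Tree A) q1 q2 →
  (∀ y → f (nodeP (y ++ q1)) ≡ nodeP (y ++ q2)) → (∀ y → s1 (nodeP (y ++ q1)) ≡ s2 (nodeP (y ++ q2))) →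
      FixesLeaves f →
  mapEdges f (treeEdges x nodeP s1 T q1) ≡ treeEdges x nodeP s2 T q2
treeEdges-move x s1 s2 f T q1 q2 hf hs lf rewrite treeEdges-shift x nodeP s1 T [] q1 | treeEdges-shift x nodeP s2 T [] q2 =
  treeEdges-rename x (at nodeP q1) (at nodeP q2) s1 s2 f T [] hf hs lf

treeVerts-move : ∀ {A} f (T : Tree A) q1 q2 → (∀ y → f (nodeP (y ++ q1)) ≡ nodeP (y ++ q2)) → FixesLeaves f →
  map f (treeVerts nodeP T q1) ≡ treeVerts nodeP T q2
treeVerts-move f T q1 q2 hf lf rewrite treeVerts-shift nodeP T [] q1 | treeVerts-shift nodeP T [] q2 =
    treeVerts-rename (at nodeP q1) (at nodeP q2) f T [] hf lf

rootV-move : ∀ {A} f (T : Tree A) q1 q2 → f (nodeP q1) ≡ nodeP q2 → FixesLeaves f →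
  f (rootV nodeP T q1) ≡ rootV nodeP T q2
rootV-move = rootV-rename nodeP nodeP

-- Paths are stored reversed, so the nodes of the subtree at p are exactly the paths y ++ p.
NotProperlyBelow : Path → Path → Set
NotProperlyBelow p y = ∀ z → y ≡ z ++ p → z ≡ []

Outside : Path → Path → Set
Outside p y = ∀ z → y ≢ z ++ p

outside⇒notProperlyBelow : ∀ {p y} → Outside p y → NotProperlyBelow p y
outside⇒notProperlyBelow o z eq = ⊥-elim (o z eq)

notProperlyBelow-above : ∀ {p} z q → p ≡ z ++ q → NotProperlyBelow p q
notProperlyBelow-above {p} z q hp w eq = LP.++-conicalˡ w z (sym (LP.++-cancelʳ q [] (w ++ z)
  (trans eq (trans (cong (w ++_) hp) (sym (LP.++-assoc w z q))))))

no-proper-suffix : ∀ a b m → m ≢ a + (b + suc m)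
no-proper-suffix a b m eq = NP.<-irrefl refl (subst (suc m N.≤_) (sym eq)
  (NP.≤-trans (NP.m≤n+m (suc m) b) (NP.m≤n+m (b + suc m) a)))

outside-above : ∀ {p} z d q → p ≡ z ++ d ∷ q → Outside p q
outside-above {p} z d q hp w eq = no-proper-suffix (length w) (length z) (length q)
  (trans (cong length (trans eq (cong (w ++_) hp)))
    (trans (LP.length-++ w) (cong (length w +_) (LP.length-++ z))))

branch-injective : ∀ y z (d e : Dir) q → y ++ d ∷ q ≡ z ++ e ∷ q → d ≡ e
branch-injective y z d e q eq = LP.∷ʳ-injectiveʳ y z (LP.++-cancelʳ q (y ∷ʳ d) (z ∷ʳ e)
  (trans (LP.++-assoc y (d ∷ []) q) (trans eq (sym (LP.++-assoc z (e ∷ []) q)))))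

outside-beside : ∀ {p} z d q d' → p ≡ z ++ d ∷ q → d ≢ d' → ∀ y → Outside p (y ++ d' ∷ q)
outside-beside {p} z d q d' hp ne y w eq = ne (sym (branch-injective y (w ++ z) d' d q
  (trans eq (trans (cong (w ++_) hp) (sym (LP.++-assoc w z (d ∷ q)))))))

holePath-extends : ∀ {A} (C : Ctx A) acc → ∃ λ z → holePath C acc ≡ z ++ acc
holePath-extends hole acc = [] , refl
holePath-extends (⊗ₗ C u) acc with holePath-extends C (l ∷ acc)
... | z , e = z ∷ʳ l , trans e (sym (LP.++-assoc z (l ∷ []) acc))
holePath-extends (⊗ᵣ u C) acc with holePath-extends C (r ∷ acc)
... | z , e = z ∷ʳ r , trans e (sym (LP.++-assoc z (r ∷ []) acc))
holePath-extends (⅋ₗ C u) acc with holePath-extends C (l ∷ acc)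
... | z , e = z ∷ʳ l , trans e (sym (LP.++-assoc z (l ∷ []) acc))
holePath-extends (⅋ᵣ u C) acc with holePath-extends C (r ∷ acc)
... | z , e = z ∷ʳ r , trans e (sym (LP.++-assoc z (r ∷ []) acc))

ctxEdges : ∀ {A} → Maybe ℕ → Switching → Ctx A → Path → List Edge
ctxEdges x s hole acc = []
ctxEdges x s (⊗ₗ C u) acc = (nodeP (l ∷ acc) , nodeP acc) ∷ childEdge x nodeP u (r ∷ acc) (nodeP acc)
  ++ ctxEdges x s C (l ∷ acc) ++ treeEdges x nodeP s u (r ∷ acc)
ctxEdges x s (⊗ᵣ u C) acc = childEdge x nodeP u (l ∷ acc) (nodeP acc)
  ++ (nodeP (r ∷ acc) , nodeP acc) ∷ treeEdges x nodeP s u (l ∷ acc) ++ ctxEdges x s C (r ∷ acc)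
ctxEdges x s (⅋ₗ C u) acc = pick (s (nodeP acc)) (childEdge x nodeP u (r ∷ acc) (nodeP acc))
    ((nodeP (l ∷ acc) , nodeP acc) ∷ [])
  ++ ctxEdges x s C (l ∷ acc) ++ treeEdges x nodeP s u (r ∷ acc)
ctxEdges x s (⅋ᵣ u C) acc = pick (s (nodeP acc)) ((nodeP (r ∷ acc) , nodeP acc) ∷ [])
    (childEdge x nodeP u (l ∷ acc) (nodeP acc))
  ++ treeEdges x nodeP s u (l ∷ acc) ++ ctxEdges x s C (r ∷ acc)

ctxVerts : ∀ {A} → Ctx A → Path → List Vertex
ctxVerts hole acc = []
ctxVerts (⊗ₗ C u) acc = nodeP acc ∷ ctxVerts C (l ∷ acc) ++ treeVerts nodeP u (r ∷ acc)
ctxVerts (⊗ᵣ u C) acc = nodeP acc ∷ treeVerts nodeP u (l ∷ acc) ++ ctxVerts C (r ∷ acc)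
ctxVerts (⅋ₗ C u) acc = nodeP acc ∷ ctxVerts C (l ∷ acc) ++ treeVerts nodeP u (r ∷ acc)
ctxVerts (⅋ᵣ u C) acc = nodeP acc ∷ treeVerts nodeP u (l ∷ acc) ++ ctxVerts C (r ∷ acc)

data Inner {A : Set} : Tree A → Set where
  inner⊗ : ∀ {t u} → Inner (t ⊗ u)
  inner⅋ : ∀ {t u} → Inner (t ⅋ u)

inner-plug : ∀ {A} (C : Ctx A) {T} → Inner T → Inner (plug C T)
inner-plug hole n = n
inner-plug (⊗ₗ C x) n = inner⊗
inner-plug (⊗ᵣ x C) n = inner⊗
inner-plug (⅋ₗ C x) n = inner⅋
inner-plug (⅋ᵣ x C) n = inner⅋

childEdge-inner : ∀ {A} x {T : Tree A} q v → Inner T → childEdge x nodeP T q v ≡ (nodeP q , v) ∷ []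
childEdge-inner nothing q v inner⊗ = refl
childEdge-inner nothing q v inner⅋ = refl
childEdge-inner (just i) q v inner⊗ = refl
childEdge-inner (just i) q v inner⅋ = refl

++-assoc₃ : ∀ {X : Set} (A B C D : List X) → A ++ B ++ C ++ D ≡ (A ++ B ++ C) ++ D
++-assoc₃ A B C D = trans (cong (λ z → A ++ z) (sym (LP.++-assoc B C D))) (sym (LP.++-assoc A (B ++ C) D))

↭-swap-middle : ∀ {X : Set} (A B C D : List X) → A ++ (B ++ C) ++ D ↭ (A ++ B ++ D) ++ C
↭-swap-middle A B C D = ↭-trans (++⁺ˡ A (↭-trans (↭-reflexive (LP.++-assoc B C D)) (++⁺ˡ B (++-comm C D))))
  (↭-reflexive (++-assoc₃ A B D C))

treeEdges-plug : ∀ {A} x s (C : Ctx A) {T} acc → Inner T →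
  treeEdges x nodeP s (plug C T) acc ↭ ctxEdges x s C acc ++ treeEdges x nodeP s T (holePath C acc)
treeEdges-plug x s hole acc n = ↭-refl
treeEdges-plug x s (⊗ₗ C u) {T} acc n rewrite childEdge-inner x (l ∷ acc) (nodeP acc) (inner-plug C n) =
  ↭-trans (prep _ (++⁺ˡ (childEdge x nodeP u (r ∷ acc) (nodeP acc)) (++⁺ʳ _ (treeEdges-plug x s C (l ∷ acc) n))))
    (↭-swap-middle (_ ∷ childEdge x nodeP u (r ∷ acc) (nodeP acc)) (ctxEdges x s C (l ∷ acc)) _ _)
treeEdges-plug x s (⊗ᵣ u C) {T} acc n rewrite childEdge-inner x (r ∷ acc) (nodeP acc) (inner-plug C n) =
  ↭-trans (++⁺ˡ (childEdge x nodeP u (l ∷ acc) (nodeP acc))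
      (prep _ (++⁺ˡ (treeEdges x nodeP s u (l ∷ acc)) (treeEdges-plug x s C (r ∷ acc) n))))
    (↭-reflexive (++-assoc₃ (childEdge x nodeP u (l ∷ acc) (nodeP acc)) (_ ∷ treeEdges x nodeP s u (l ∷ acc))
        (ctxEdges x s C (r ∷ acc)) _))
treeEdges-plug x s (⅋ₗ C u) {T} acc n rewrite treeEdges-⅋ x nodeP s (plug C T) u acc | childEdge-inner x (l ∷ acc)
    (nodeP acc) (inner-plug C n) =
  ↭-trans (++⁺ˡ (pick (s (nodeP acc)) (childEdge x nodeP u (r ∷ acc) (nodeP acc))
      ((nodeP (l ∷ acc) , nodeP acc) ∷ [])) (++⁺ʳ _ (treeEdges-plug x s C (l ∷ acc) n)))
    (↭-swap-middle (pick (s (nodeP acc)) (childEdge x nodeP u (r ∷ acc) (nodeP acc))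
        ((nodeP (l ∷ acc) , nodeP acc) ∷ [])) (ctxEdges x s C (l ∷ acc)) _ _)
treeEdges-plug x s (⅋ᵣ u C) {T} acc n rewrite treeEdges-⅋ x nodeP s u (plug C T) acc | childEdge-inner x (r ∷ acc)
    (nodeP acc) (inner-plug C n) =
  ↭-trans (++⁺ˡ (pick (s (nodeP acc)) ((nodeP (r ∷ acc) , nodeP acc) ∷ [])
      (childEdge x nodeP u (l ∷ acc) (nodeP acc)))
          (++⁺ˡ (treeEdges x nodeP s u (l ∷ acc)) (treeEdges-plug x s C (r ∷ acc) n)))
    (↭-reflexive (++-assoc₃ (pick (s (nodeP acc)) ((nodeP (r ∷ acc) , nodeP acc) ∷ [])
        (childEdge x nodeP u (l ∷ acc) (nodeP acc))) (treeEdges x nodeP s u (l ∷ acc)) (ctxEdges x s C (r ∷ acc)) _))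

treeVerts-plug : ∀ {A} (C : Ctx A) {T} acc →
  treeVerts nodeP (plug C T) acc ↭ ctxVerts C acc ++ treeVerts nodeP T (holePath C acc)
treeVerts-plug hole acc = ↭-refl
treeVerts-plug (⊗ₗ C u) acc = ↭-trans (prep _ (++⁺ʳ _ (treeVerts-plug C (l ∷ acc))))
    (↭-swap-middle (nodeP acc ∷ []) (ctxVerts C (l ∷ acc)) _ _)
treeVerts-plug (⊗ᵣ u C) acc = ↭-trans (prep _ (++⁺ˡ (treeVerts nodeP u (l ∷ acc)) (treeVerts-plug C (r ∷ acc))))
  (↭-reflexive (++-assoc₃ (nodeP acc ∷ []) (treeVerts nodeP u (l ∷ acc)) (ctxVerts C (r ∷ acc)) _))
treeVerts-plug (⅋ₗ C u) acc = ↭-trans (prep _ (++⁺ʳ _ (treeVerts-plug C (l ∷ acc))))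
    (↭-swap-middle (nodeP acc ∷ []) (ctxVerts C (l ∷ acc)) _ _)
treeVerts-plug (⅋ᵣ u C) acc = ↭-trans (prep _ (++⁺ˡ (treeVerts nodeP u (l ∷ acc)) (treeVerts-plug C (r ∷ acc))))
  (↭-reflexive (++-assoc₃ (nodeP acc ∷ []) (treeVerts nodeP u (l ∷ acc)) (ctxVerts C (r ∷ acc)) _))

sibling-rename : ∀ {A} x f s1 s2 (u : Tree A) q v v' → (∀ y → f (nodeP (y ++ q)) ≡ nodeP (y ++ q)) →
  (∀ y → s1 (nodeP (y ++ q)) ≡ s2 (nodeP (y ++ q))) → FixesLeaves f → f v ≡ v' →
  mapEdges f (childEdge x nodeP u q v) ≡ childEdge x nodeP u q v' ×
  mapEdges f (treeEdges x nodeP s1 u q) ≡ treeEdges x nodeP s2 u q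
sibling-rename x f s1 s2 u q v v' hf hs lf ev =
  trans (childEdge-rename x nodeP nodeP f u q q v (hf []) lf) (cong (childEdge x nodeP u q) ev) ,
  treeEdges-move x s1 s2 f u q q hf hs lf

ctxEdges-rename : ∀ {A} x (C : Ctx A) acc f s1 s2 →
  (∀ y → NotProperlyBelow (holePath C acc) y → f (nodeP y) ≡ nodeP y) →
  (∀ y → Outside (holePath C acc) y → s1 (nodeP y) ≡ s2 (nodeP y)) →
  FixesLeaves f → mapEdges f (ctxEdges x s1 C acc) ≡ ctxEdges x s2 C acc
ctxEdges-rename x hole acc f s1 s2 hN hS lf = refl
ctxEdges-rename x (⊗ₗ C u) acc f s1 s2 hN hS lf with holePath-extends C (l ∷ acc)
... | z , hp with sibling-rename x f s1 s2 u (r ∷ acc) (nodeP acc) (nodeP acc)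
        (λ y → hN _ (outside⇒notProperlyBelow (outside-beside z l acc r hp (λ ()) y)))
            (λ y → hS _ (outside-beside z l acc r hp (λ ()) y)) lf
        (hN acc (outside⇒notProperlyBelow (outside-above z l acc hp)))
... | e1 , e2 = cong₂ _∷_ (cong₂ _,_ (hN (l ∷ acc) (notProperlyBelow-above z (l ∷ acc) hp))
    (hN acc (outside⇒notProperlyBelow (outside-above z l acc hp))))
  (trans (mapEdges-++ f (childEdge x nodeP u (r ∷ acc) (nodeP acc)) _)
      (cong₂ _++_ e1 (trans (mapEdges-++ f (ctxEdges x s1 C (l ∷ acc)) _)
          (cong₂ _++_ (ctxEdges-rename x C (l ∷ acc) f s1 s2 hN hS lf) e2))))
ctxEdges-rename x (⊗ᵣ u C) acc f s1 s2 hN hS lf with holePath-extends C (r ∷ acc)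
... | z , hp with sibling-rename x f s1 s2 u (l ∷ acc) (nodeP acc) (nodeP acc)
        (λ y → hN _ (outside⇒notProperlyBelow (outside-beside z r acc l hp (λ ()) y)))
            (λ y → hS _ (outside-beside z r acc l hp (λ ()) y)) lf
        (hN acc (outside⇒notProperlyBelow (outside-above z r acc hp)))
... | e1 , e2 = trans (mapEdges-++ f (childEdge x nodeP u (l ∷ acc) (nodeP acc)) _) (cong₂ _++_ e1
   (cong₂ _∷_ (cong₂ _,_ (hN (r ∷ acc) (notProperlyBelow-above z (r ∷ acc) hp))
       (hN acc (outside⇒notProperlyBelow (outside-above z r acc hp))))
     (trans (mapEdges-++ f (treeEdges x nodeP s1 u (l ∷ acc)) _)
         (cong₂ _++_ e2 (ctxEdges-rename x C (r ∷ acc) f s1 s2 hN hS lf)))))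
ctxEdges-rename x (⅋ₗ C u) acc f s1 s2 hN hS lf with holePath-extends C (l ∷ acc)
... | z , hp with sibling-rename x f s1 s2 u (r ∷ acc) (nodeP acc) (nodeP acc)
        (λ y → hN _ (outside⇒notProperlyBelow (outside-beside z l acc r hp (λ ()) y)))
            (λ y → hS _ (outside-beside z l acc r hp (λ ()) y)) lf
        (hN acc (outside⇒notProperlyBelow (outside-above z l acc hp)))
... | e1 , e2 rewrite hS acc (outside-above z l acc hp) =
  trans (mapEdges-++ f (pick (s2 (nodeP acc)) (childEdge x nodeP u (r ∷ acc) (nodeP acc)) ((nodeP (l ∷ acc) , nodeP acc) ∷ [])) _) (cong₂ _++_
    (trans (mapEdges-pick f (s2 (nodeP acc)) _ _) (cong₂ (pick (s2 (nodeP acc))) e1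
       (cong (_∷ []) (cong₂ _,_ (hN (l ∷ acc) (notProperlyBelow-above z (l ∷ acc) hp))
           (hN acc (outside⇒notProperlyBelow (outside-above z l acc hp)))))))
    (trans (mapEdges-++ f (ctxEdges x s1 C (l ∷ acc)) _)
        (cong₂ _++_ (ctxEdges-rename x C (l ∷ acc) f s1 s2 hN hS lf) e2)))
ctxEdges-rename x (⅋ᵣ u C) acc f s1 s2 hN hS lf with holePath-extends C (r ∷ acc)
... | z , hp with sibling-rename x f s1 s2 u (l ∷ acc) (nodeP acc) (nodeP acc)
        (λ y → hN _ (outside⇒notProperlyBelow (outside-beside z r acc l hp (λ ()) y)))
            (λ y → hS _ (outside-beside z r acc l hp (λ ()) y)) lf
        (hN acc (outside⇒notProperlyBelow (outside-above z r acc hp)))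
... | e1 , e2 rewrite hS acc (outside-above z r acc hp) =
  trans (mapEdges-++ f (pick (s2 (nodeP acc)) ((nodeP (r ∷ acc) , nodeP acc) ∷ []) (childEdge x nodeP u (l ∷ acc) (nodeP acc))) _) (cong₂ _++_
    (trans (mapEdges-pick f (s2 (nodeP acc)) _ _) (cong₂ (pick (s2 (nodeP acc)))
       (cong (_∷ []) (cong₂ _,_ (hN (r ∷ acc) (notProperlyBelow-above z (r ∷ acc) hp)) (hN acc (outside⇒notProperlyBelow (outside-above z r acc hp))))) e1))
    (trans (mapEdges-++ f (treeEdges x nodeP s1 u (l ∷ acc)) _)
        (cong₂ _++_ e2 (ctxEdges-rename x C (r ∷ acc) f s1 s2 hN hS lf))))

ctxVerts-rename : ∀ {A} (C : Ctx A) acc f →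
  (∀ y → NotProperlyBelow (holePath C acc) y → f (nodeP y) ≡ nodeP y) → FixesLeaves f →
  map f (ctxVerts C acc) ≡ ctxVerts C acc
ctxVerts-rename hole acc f hN lf = refl
ctxVerts-rename (⊗ₗ C u) acc f hN lf with holePath-extends C (l ∷ acc)
... | z , hp = cong₂ _∷_ (hN acc (outside⇒notProperlyBelow (outside-above z l acc hp)))
  (trans (LP.map-++ f (ctxVerts C (l ∷ acc)) _) (cong₂ _++_ (ctxVerts-rename C (l ∷ acc) f hN lf)
    (treeVerts-move f u (r ∷ acc) (r ∷ acc) (λ y →
        hN _ (outside⇒notProperlyBelow (outside-beside z l acc r hp (λ ()) y))) lf)))
ctxVerts-rename (⊗ᵣ u C) acc f hN lf with holePath-extends C (r ∷ acc)
... | z , hp = cong₂ _∷_ (hN acc (outside⇒notProperlyBelow (outside-above z r acc hp)))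
  (trans (LP.map-++ f (treeVerts nodeP u (l ∷ acc)) _) (cong₂ _++_
    (treeVerts-move f u (l ∷ acc) (l ∷ acc) (λ y → hN _ (outside⇒notProperlyBelow (outside-beside z r acc l hp (λ ()) y))) lf) (ctxVerts-rename C (r ∷ acc) f hN lf)))
ctxVerts-rename (⅋ₗ C u) acc f hN lf with holePath-extends C (l ∷ acc)
... | z , hp = cong₂ _∷_ (hN acc (outside⇒notProperlyBelow (outside-above z l acc hp)))
  (trans (LP.map-++ f (ctxVerts C (l ∷ acc)) _) (cong₂ _++_ (ctxVerts-rename C (l ∷ acc) f hN lf)
    (treeVerts-move f u (r ∷ acc) (r ∷ acc) (λ y →
        hN _ (outside⇒notProperlyBelow (outside-beside z l acc r hp (λ ()) y))) lf)))
ctxVerts-rename (⅋ᵣ u C) acc f hN lf with holePath-extends C (r ∷ acc)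
... | z , hp = cong₂ _∷_ (hN acc (outside⇒notProperlyBelow (outside-above z r acc hp)))
  (trans (LP.map-++ f (treeVerts nodeP u (l ∷ acc)) _) (cong₂ _++_
    (treeVerts-move f u (l ∷ acc) (l ∷ acc) (λ y → hN _ (outside⇒notProperlyBelow (outside-beside z r acc l hp (λ ()) y))) lf) (ctxVerts-rename C (r ∷ acc) f hN lf)))

seqEdges-rename : ∀ {A} f s1 s2 (Γ : Sequent A) k → (∀ k q → f (nodeΓ k q) ≡ nodeΓ k q) →
  (∀ k q → s1 (nodeΓ k q) ≡ s2 (nodeΓ k q)) → FixesLeaves f → mapEdges f (seqEdges s1 Γ k) ≡ seqEdges s2 Γ k
seqEdges-rename f s1 s2 [] k hf hs lf = refl
seqEdges-rename f s1 s2 (F ∷ Γ) k hf hs lf = trans (mapEdges-++ f (treeEdges nothing (nodeΓ k) s1 F []) _)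
  (cong₂ _++_ (treeEdges-rename nothing (nodeΓ k) (nodeΓ k) s1 s2 f F [] (hf k) (hs k) lf)
      (seqEdges-rename f s1 s2 Γ (suc k) hf hs lf))

seqVerts-rename : ∀ {A} f (Γ : Sequent A) k → (∀ k q → f (nodeΓ k q) ≡ nodeΓ k q) → FixesLeaves f →
  map f (seqVerts Γ k) ≡ seqVerts Γ k
seqVerts-rename f [] k hf lf = refl
seqVerts-rename f (F ∷ Γ) k hf lf = trans (LP.map-++ f (treeVerts (nodeΓ k) F []) _)
  (cong₂ _++_ (treeVerts-rename (nodeΓ k) (nodeΓ k) f F [] (hf k) lf) (seqVerts-rename f Γ (suc k) hf lf))

record Local (p : Path) (f : Vertex → Vertex) : Set where
  field
    fixes-outside : ∀ y → NotProperlyBelow p y → f (nodeP y) ≡ nodeP y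
    fixes-Γ : ∀ k q → f (nodeΓ k q) ≡ nodeΓ k q
    fixes-leaves : FixesLeaves f
open Local public

AgreeOutside : Path → Switching → Switching → Set
AgreeOutside p s1 s2 = (∀ y → Outside p y → s1 (nodeP y) ≡ s2 (nodeP y)) ×
    (∀ k q → s1 (nodeΓ k q) ≡ s2 (nodeΓ k q))

local-∘ : ∀ {p f g} → Local p f → Local p g → Local p (λ v → g (f v))
local-∘ {g = g} Gf Gg = record
  { fixes-outside = λ y nb → trans (cong g (fixes-outside Gf y nb)) (fixes-outside Gg y nb)
  ; fixes-Γ = λ k q → trans (cong g (fixes-Γ Gf k q)) (fixes-Γ Gg k q)
  ; fixes-leaves = λ i → trans (cong g (fixes-leaves Gf i)) (fixes-leaves Gg i) }

outerEdges : ∀ {A} → Maybe ℕ → Switching → Ctx A → Sequent A → List Edge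
outerEdges x s C Γ = ctxEdges x s C [] ++ seqEdges s Γ 0

outerVerts : ∀ {A} → Ctx A → Sequent A → List Vertex
outerVerts C Γ = ctxVerts C [] ++ seqVerts Γ 0

outerEdges-rename : ∀ {A} x (C : Ctx A) Γ f s1 s2 → Local (holePath C []) f → AgreeOutside (holePath C []) s1 s2 →
  mapEdges f (outerEdges x s1 C Γ) ≡ outerEdges x s2 C Γ
outerEdges-rename x C Γ f s1 s2 G (a1 , a2) = trans (mapEdges-++ f (ctxEdges x s1 C []) _)
  (cong₂ _++_ (ctxEdges-rename x C [] f s1 s2 (fixes-outside G) a1 (fixes-leaves G))
      (seqEdges-rename f s1 s2 Γ 0 (fixes-Γ G) a2 (fixes-leaves G)))

outerVerts-rename : ∀ {A} (C : Ctx A) Γ f → Local (holePath C []) f → map f (outerVerts C Γ) ≡ outerVerts C Γ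
outerVerts-rename C Γ f G = trans (LP.map-++ f (ctxVerts C []) _)
    (cong₂ _++_ (ctxVerts-rename C [] f (fixes-outside G) (fixes-leaves G))
        (seqVerts-rename f Γ 0 (fixes-Γ G) (fixes-leaves G)))

switchGraph-plug : ∀ {A} x s (C : Ctx A) {T} Γ → Inner T →
  switchGraph x s (plug C T) Γ ↭ outerEdges x s C Γ ++ treeEdges x nodeP s T (holePath C [])
switchGraph-plug x s C Γ n = ↭-trans (++⁺ʳ (seqEdges s Γ 0) (treeEdges-plug x s C [] n))
    (↭-swap-middle [] (ctxEdges x s C []) _ _)

verts-plug : ∀ {A} (C : Ctx A) {T} Γ → verts (plug C T) Γ ↭ outerVerts C Γ ++ treeVerts nodeP T (holePath C [])
verts-plug C Γ = ↭-trans (++⁺ʳ (seqVerts Γ 0) (treeVerts-plug C [])) (↭-swap-middle [] (ctxVerts C []) _ _)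

drop-length : ∀ (z p : Path) → drop (length z) (z ++ p) ≡ p
drop-length [] p = refl
drop-length (x ∷ z) p = drop-length z p

take-length : ∀ (z p : Path) → take (length z) (z ++ p) ≡ z
take-length [] p = refl
take-length (x ∷ z) p = cong (x ∷_) (take-length z p)

stripAt : Path → Path → ℕ → Maybe Path
stripAt p x k with path-≟ (drop k x) p
... | yes _ = just (take k x)
... | no _ = nothing

stripSuffix : Path → Path → Maybe Path
stripSuffix p x = stripAt p x (length x ∸ length p)

stripAt-sound : ∀ p x k z → stripAt p x k ≡ just z → x ≡ z ++ p
stripAt-sound p x k z eq with path-≟ (drop k x) p
stripAt-sound p x k z refl | yes e = trans (sym (LP.take++drop≡id k x)) (cong (take k x ++_) e)
stripAt-sound p x k z () | no _

stripSuffix-sound : ∀ p x z → stripSuffix p x ≡ just z → x ≡ z ++ p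
stripSuffix-sound p x z = stripAt-sound p x _ z

stripSuffix-complete : ∀ p z → stripSuffix p (z ++ p) ≡ just z
stripSuffix-complete p z rewrite LP.length-++ z {p} | NP.m+n∸n≡m (length z) (length p) with path-≟
    (drop (length z) (z ++ p)) p
... | yes _ = cong just (take-length z p)
... | no ne = ⊥-elim (ne (drop-length z p))

-- Moving and merging vertices below the hole

-- relocate p φ rewrites by φ the path from p down to each node below p (stored reversed, hence the reverses).
relocateAt : Path → (Path → Path) → Path → Maybe Path → Vertex
relocateAt p φ x nothing = nodeP x
relocateAt p φ x (just z) = nodeP (reverse (φ (reverse z)) ++ p)

relocate : Path → (Path → Path) → Vertex → Vertex
relocate p φ (leafV i) = leafV i
relocate p φ (nodeP x) = relocateAt p φ x (stripSuffix p x)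
relocate p φ (nodeΓ k q) = nodeΓ k q

relocate-below : ∀ p φ a b → (∀ w → φ (a ++ w) ≡ b ++ w) →
  ∀ y → relocate p φ (nodeP (y ++ reverse a ++ p)) ≡ nodeP (y ++ reverse b ++ p)
relocate-below p φ a b h y rewrite sym (LP.++-assoc y (reverse a) p) | stripSuffix-complete p (y ++ reverse a)
  | LP.reverse-++ y (reverse a) | LP.reverse-involutive a | h (reverse y)
  | LP.reverse-++ b (reverse y) | LP.reverse-involutive y = cong nodeP (LP.++-assoc y (reverse b) p)

relocate-local : ∀ p φ → φ [] ≡ [] → Local p (relocate p φ)
relocate-local p φ h = record { fixes-outside = nb ; fixes-Γ = λ k q → refl ; fixes-leaves = λ i → refl }
  where
  nb : ∀ y → NotProperlyBelow p y → relocate p φ (nodeP y) ≡ nodeP y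
  nb y n with stripSuffix p y in eq
  ... | nothing = refl
  ... | just z with n z (stripSuffix-sound p y z eq)
  ...   | refl rewrite h = cong nodeP (sym (stripSuffix-sound p y [] eq))

nodeP-inj : ∀ {x y} → nodeP x ≡ nodeP y → x ≡ y
nodeP-inj refl = refl

relocate-injective : ∀ p φ → (∀ a b → φ a ≡ φ b → a ≡ b) → ∀ u v → relocate p φ u ≡ relocate p φ v → u ≡ v
relocate-injective p φ inj (leafV i) (leafV j) eq = eq
relocate-injective p φ inj (nodeΓ k q) (nodeΓ k' q') eq = eq
relocate-injective p φ inj (leafV i) (nodeP y) eq with stripSuffix p y
relocate-injective p φ inj (leafV i) (nodeP y) () | nothing
relocate-injective p φ inj (leafV i) (nodeP y) () | just _
relocate-injective p φ inj (nodeΓ k q) (nodeP y) eq with stripSuffix p y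
relocate-injective p φ inj (nodeΓ k q) (nodeP y) () | nothing
relocate-injective p φ inj (nodeΓ k q) (nodeP y) () | just _
relocate-injective p φ inj (nodeP x) (leafV i) eq with stripSuffix p x
relocate-injective p φ inj (nodeP x) (leafV i) () | nothing
relocate-injective p φ inj (nodeP x) (leafV i) () | just _
relocate-injective p φ inj (nodeP x) (nodeΓ k q) eq with stripSuffix p x
relocate-injective p φ inj (nodeP x) (nodeΓ k q) () | nothing
relocate-injective p φ inj (nodeP x) (nodeΓ k q) () | just _
relocate-injective p φ inj (leafV i) (nodeΓ k q) ()
relocate-injective p φ inj (nodeΓ k q) (leafV i) ()
relocate-injective p φ inj (nodeP x) (nodeP y) eq with stripSuffix p x in e1 | stripSuffix p y in e2
... | nothing | nothing = eq
... | just z | just z' = cong nodeP (trans (stripSuffix-sound p x z e1)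
    (trans (cong (_++ p) zz) (sym (stripSuffix-sound p y z' e2))))
  where
  zz : z ≡ z'
  zz = LP.reverse-injective (inj _ _ (LP.reverse-injective (LP.++-cancelʳ p _ _ (nodeP-inj eq))))
... | just z | nothing with trans (sym (stripSuffix-complete p _)) (cong (stripSuffix p) (nodeP-inj eq))
...   | e3 with trans e3 e2
...     | ()
relocate-injective p φ inj (nodeP x) (nodeP y) eq | nothing | just z' with trans (sym (stripSuffix-complete p _))
    (cong (stripSuffix p) (sym (nodeP-inj eq)))
...   | e3 with trans e3 e1
...     | ()

merge : Vertex → Vertex → Vertex → Vertex
merge w u v with vertex-≟ v w
... | yes _ = u
... | no _ = v

merge-other : ∀ w u v → v ≢ w → merge w u v ≡ v
merge-other w u v ne with vertex-≟ v w
... | yes e = ⊥-elim (ne e)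
... | no _ = refl

merge-self : ∀ w u → merge w u w ≡ u
merge-self w u with vertex-≟ w w
... | yes _ = refl
... | no ne = ⊥-elim (ne refl)

merge-collapses : ∀ w u → u ≢ w → merge w u u ≡ merge w u w
merge-collapses w u ne = trans (merge-other w u u ne) (sym (merge-self w u))

merge-fibre : ∀ w u x y → merge w u x ≡ merge w u y → Reach ((u , w) ∷ []) x y
merge-fibre w u x y eq with vertex-≟ x w | vertex-≟ y w
... | yes refl | yes refl = ε
... | yes refl | no _ rewrite eq = against (here refl)
... | no _ | yes refl rewrite eq = along (here refl)
... | no _ | no _ rewrite eq = ε

merge-local : ∀ p w u → (∀ y → NotProperlyBelow p y → nodeP y ≢ w) → (∀ k q → nodeΓ k q ≢ w) →
  (∀ i → leafV i ≢ w) →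
  Local p (merge w u)
merge-local p w u h1 h2 h3 = record
  { fixes-outside = λ y nb → merge-other w u _ (h1 y nb)
  ; fixes-Γ = λ k q → merge-other w u _ (h2 k q)
  ; fixes-leaves = λ i → merge-other w u _ (h3 i) }

override : Vertex → Dir → Switching → Switching
override g d s v with vertex-≟ v g
... | yes _ = d
... | no _ = s v

override-other : ∀ g d s v → v ≢ g → override g d s v ≡ s v
override-other g d s v ne with vertex-≟ v g
... | yes e = ⊥-elim (ne e)
... | no _ = refl

override-self : ∀ g d s → override g d s g ≡ d
override-self g d s with vertex-≟ g g
... | yes _ = refl
... | no ne = ⊥-elim (ne refl)

-- Transfer across a rewriting step

AllSwitchingsTrees : ∀ {A} → Tree A → Sequent A → Set
AllSwitchingsTrees P Γ = ∀ s → SpanningTree (switchGraph nothing s P Γ) (verts P Γ)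

agreeOutside-refl : ∀ {p s} → AgreeOutside p s s
agreeOutside-refl = (λ _ _ → refl) , (λ _ _ → refl)

below≢ : ∀ y d p → y ++ d ∷ p ≢ p
below≢ y d p eq = outside-above y d p refl [] (sym eq)

reach-flip : ∀ {a b x y} → Reach ((a , b) ∷ []) x y → Reach ((b , a) ∷ []) x y
reach-flip = reach-via (λ { (here refl) → against (here refl) })

nodeP-≢ : ∀ {x y} → x ≢ y → nodeP x ≢ nodeP y
nodeP-≢ ne e = ne (nodeP-inj e)

root≢child : ∀ P d → nodeP P ≢ nodeP (d ∷ P)
root≢child P d e = below≢ [] d P (sym (nodeP-inj e))

local-root : ∀ {P f} → Local P f → f (nodeP P) ≡ nodeP P
local-root {P} G = fixes-outside G P (notProperlyBelow-above [] P refl)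

merge-child-local : ∀ P d u → Local P (merge (nodeP (d ∷ P)) u)
merge-child-local P d u = merge-local P _ u (λ y nb e → child≢root (nb (d ∷ []) (nodeP-inj e))) (λ _ _ ()) (λ _ ())
  where
  child≢root : d ∷ [] ≢ []
  child≢root ()

inverse⇒injective : ∀ {f : Path → Path} g → (∀ a → g (f a) ≡ a) → ∀ a b → f a ≡ f b → a ≡ b
inverse⇒injective g gf a b e = trans (sym (gf a)) (trans (cong g e) (gf b))

module _ {A : Set} (C : Ctx A) (Γ : Sequent A) where

  p : Path
  p = holePath C []

  split-graph : ∀ {T} s → Inner T → SpanningTree (switchGraph nothing s (plug C T) Γ) (verts (plug C T) Γ) →
    SpanningTree (outerEdges nothing s C Γ ++ treeEdges nothing nodeP s T p) (verts (plug C T) Γ)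
  split-graph s n = spanningTree-↭ (switchGraph-plug nothing s C Γ n)

  unsplit-graph : ∀ {T} s → Inner T → SpanningTree (outerEdges nothing s C Γ ++ treeEdges nothing nodeP s T p)
      (verts (plug C T) Γ) →
    SpanningTree (switchGraph nothing s (plug C T) Γ) (verts (plug C T) Γ)
  unsplit-graph s n = spanningTree-↭ (↭-sym (switchGraph-plug nothing s C Γ n))

  transfer-contract : ∀ (T1 : Tree A) s1 s2 g (K1 : List Edge) M1 L1 (N : List Edge) (W : List Vertex) →
    Local p g → AgreeOutside p s1 s2 →
    (∀ {a b} → (a , b) ∈ K1 → g a ≡ g b) → (∀ x y → g x ≡ g y → Reach K1 x y) →
    M1 ↭ K1 ++ L1 → mapEdges g L1 ↭ N → W ⊆ map g (treeVerts nodeP T1 p) →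
    SpanningTree (outerEdges nothing s1 C Γ ++ M1) (verts (plug C T1) Γ) →
    SpanningTree (outerEdges nothing s2 C Γ ++ N) (outerVerts C Γ ++ W)
  transfer-contract T1 s1 s2 g K1 M1 L1 N W Gg ag col fib pM1 pL vs t0 = spanningTree-↭ eq t2
    where
    B1 = outerEdges nothing s1 C Γ
    B2 = outerEdges nothing s2 C Γ
    t1 : SpanningTree (K1 ++ (B1 ++ L1)) (verts (plug C T1) Γ)
    t1 = spanningTree-↭ (↭-trans (++⁺ˡ B1 pM1) (shifts B1 K1)) t0
    vs' : outerVerts C Γ ++ W ⊆ map g (verts (plug C T1) Γ)
    vs' m with ∈-++⁻ (outerVerts C Γ) m
    ... | inj₁ mb = ∈-resp-↭ (map⁺ g (↭-sym (verts-plug C Γ)))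
          (subst (_ ∈_) (sym (LP.map-++ g (outerVerts C Γ) (treeVerts nodeP T1 p)))
            (∈-++⁺ˡ (subst (_ ∈_) (sym (outerVerts-rename C Γ g Gg)) mb)))
    ... | inj₂ mw = ∈-resp-↭ (map⁺ g (↭-sym (verts-plug C Γ)))
          (subst (_ ∈_) (sym (LP.map-++ g (outerVerts C Γ) (treeVerts nodeP T1 p)))
            (∈-++⁺ʳ (map g (outerVerts C Γ)) (vs mw)))
    t2 : SpanningTree (mapEdges g (B1 ++ L1)) (outerVerts C Γ ++ W)
    t2 = contract-spanningTree g K1 (B1 ++ L1) _ _ col fib vs' t1
    eq : mapEdges g (B1 ++ L1) ↭ B2 ++ N
    eq = ↭-trans (↭-reflexive (trans (mapEdges-++ g B1 L1)
        (cong (_++ mapEdges g L1) (outerEdges-rename nothing C Γ g s1 s2 Gg ag))))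
         (++⁺ˡ B2 pL)

  transfer-expand : ∀ (T2 : Tree A) s2 h u2 w2 M2 L2 (N : List Edge) (W : List Vertex) →
    Local p h → u2 ≢ w2 → h u2 ≡ h w2 → (∀ x y → h x ≡ h y → Reach ((u2 , w2) ∷ []) x y) →
    M2 ↭ (u2 , w2) ∷ L2 → mapEdges h L2 ↭ N → map h (treeVerts nodeP T2 p) ⊆ W →
    SpanningTree (outerEdges nothing s2 C Γ ++ N) (outerVerts C Γ ++ W) →
    SpanningTree (outerEdges nothing s2 C Γ ++ M2) (verts (plug C T2) Γ)
  transfer-expand T2 s2 h u2 w2 M2 L2 N W Gh ne col2 fib2 pM2 pL vs t0 =
    spanningTree-↭ (↭-sym (↭-trans (++⁺ˡ B2 pM2) (shift (u2 , w2) B2 L2))) t4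
    where
    B2 = outerEdges nothing s2 C Γ
    eq : B2 ++ N ↭ mapEdges h (B2 ++ L2)
    eq = ↭-trans (++⁺ˡ B2 (↭-sym pL))
         (↭-reflexive (sym (trans (mapEdges-++ h B2 L2)
             (cong (_++ mapEdges h L2) (outerEdges-rename nothing C Γ h s2 s2 Gh (agreeOutside-refl {p} {s2}))))))
    vs' : ∀ {v} → v ∈ verts (plug C T2) Γ → h v ∈ outerVerts C Γ ++ W
    vs' m with ∈-++⁻ (outerVerts C Γ) (∈-resp-↭ (verts-plug C Γ) m)
    ... | inj₁ mb = ∈-++⁺ˡ (subst (_ ∈_) (outerVerts-rename C Γ h Gh) (∈-map⁺ h mb))
    ... | inj₂ mt = ∈-++⁺ʳ (outerVerts C Γ) (vs (∈-map⁺ h mt))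
    t4 : SpanningTree ((u2 , w2) ∷ (B2 ++ L2)) (verts (plug C T2) Γ)
    t4 = expand-spanningTree h u2 w2 (B2 ++ L2) _ _ ne col2 fib2 vs' (spanningTree-↭ eq t0)

  transfer-contract-expand : ∀ (T1 T2 : Tree A) s1 s2 g h (K1 : List Edge) M1 L1 M2 L2 u2 w2 →
    Local p g → Local p h → AgreeOutside p s1 s2 →
    (∀ {a b} → (a , b) ∈ K1 → g a ≡ g b) → (∀ x y → g x ≡ g y → Reach K1 x y) →
    u2 ≢ w2 → h u2 ≡ h w2 → (∀ x y → h x ≡ h y → Reach ((u2 , w2) ∷ []) x y) →
    M1 ↭ K1 ++ L1 → M2 ↭ (u2 , w2) ∷ L2 → mapEdges g L1 ↭ mapEdges h L2 →
    map h (treeVerts nodeP T2 p) ⊆ map g (treeVerts nodeP T1 p) →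
    SpanningTree (outerEdges nothing s1 C Γ ++ M1) (verts (plug C T1) Γ) →
    SpanningTree (outerEdges nothing s2 C Γ ++ M2) (verts (plug C T2) Γ)
  transfer-contract-expand T1 T2 s1 s2 g h K1 M1 L1 M2 L2 u2 w2 Gg Gh ag col fib ne col2 fib2 pM1 pM2 pL vs =
    transfer-expand T2 s2 h u2 w2 M2 L2 _ _ Gh ne col2 fib2 pM2 ↭-refl ⊆-refl
    ∘ transfer-contract T1 s1 s2 g K1 M1 L1 _ _ Gg ag col fib pM1 pL vs

  transfer-rename : ∀ (T1 T2 : Tree A) s1 s2 g → Local p g → AgreeOutside p s1 s2 → (∀ x y → g x ≡ g y → x ≡ y) →
    mapEdges g (treeEdges nothing nodeP s1 T1 p) ↭ treeEdges nothing nodeP s2 T2 p →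
    treeVerts nodeP T2 p ⊆ map g (treeVerts nodeP T1 p) →
    SpanningTree (outerEdges nothing s1 C Γ ++ treeEdges nothing nodeP s1 T1 p) (verts (plug C T1) Γ) →
    SpanningTree (outerEdges nothing s2 C Γ ++ treeEdges nothing nodeP s2 T2 p) (verts (plug C T2) Γ)
  transfer-rename T1 T2 s1 s2 g Gg ag inj pL vs =
    spanningTree-resp ↭-refl (⊆-reflexive-↭ (verts-plug C Γ))
    ∘ transfer-contract T1 s1 s2 g [] _ _ _ _ Gg ag (λ ()) (λ x y e → subst (Reach [] x) (inj x y e) ε) ↭-refl pL vs

-- The rewriting steps

swapTop : Path → Path
swapTop [] = []
swapTop (l ∷ w) = r ∷ w
swapTop (r ∷ w) = l ∷ w

swapTop-involutive : ∀ a → swapTop (swapTop a) ≡ a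
swapTop-involutive [] = refl
swapTop-involutive (l ∷ a) = refl
swapTop-involutive (r ∷ a) = refl

flipDir : Dir → Dir
flipDir l = r
flipDir r = l

module _ {A : Set} (C : Ctx A) (Γ : Sequent A) (Q R : Tree A) where

  private
    P = holePath C []
    g = relocate P swapTop
    Gg : Local P g
    Gg = relocate-local P swapTop refl
    g-left : ∀ y → g (nodeP (y ++ l ∷ P)) ≡ nodeP (y ++ r ∷ P)
    g-left = relocate-below P swapTop (l ∷ []) (r ∷ []) (λ _ → refl)
    g-right : ∀ y → g (nodeP (y ++ r ∷ P)) ≡ nodeP (y ++ l ∷ P)
    g-right = relocate-below P swapTop (r ∷ []) (l ∷ []) (λ _ → refl)
    g-injective : ∀ x y → g x ≡ g y → x ≡ y
    g-injective = relocate-injective P swapTop (inverse⇒injective swapTop swapTop-involutive)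
    rQ = rootV nodeP Q (r ∷ P)
    rR = rootV nodeP R (l ∷ P)
    g-rQ : g (rootV nodeP Q (l ∷ P)) ≡ rQ
    g-rQ = rootV-move g Q _ _ (g-left []) (fixes-leaves Gg)
    g-rR : g (rootV nodeP R (r ∷ P)) ≡ rR
    g-rR = rootV-move g R _ _ (g-right []) (fixes-leaves Gg)

    swapped-verts : treeVerts nodeP (R ⊗ Q) P ⊆ map g (treeVerts nodeP (Q ⊗ R) P)
    swapped-verts = subst (treeVerts nodeP (R ⊗ Q) P ⊆_) (sym g-verts)
      (⊆-reflexive-↭ (prep _ (++-comm (treeVerts nodeP R (l ∷ P)) _)))
      where
      g-verts : map g (treeVerts nodeP (Q ⊗ R) P) ≡ nodeP P ∷ treeVerts nodeP Q (r ∷ P) ++ treeVerts nodeP R (l ∷ P)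
      g-verts = cong₂ _∷_ (local-root Gg) (trans (LP.map-++ g (treeVerts nodeP Q (l ∷ P)) _)
        (cong₂ _++_ (treeVerts-move g Q _ _ g-left (fixes-leaves Gg))
            (treeVerts-move g R _ _ g-right (fixes-leaves Gg))))

    swapped-subtrees : ∀ s1 s2 →
      (∀ y → s1 (nodeP (y ++ l ∷ P)) ≡ s2 (nodeP (y ++ r ∷ P))) →
          (∀ y → s1 (nodeP (y ++ r ∷ P)) ≡ s2 (nodeP (y ++ l ∷ P))) →
      mapEdges g (treeEdges nothing nodeP s1 Q (l ∷ P) ++ treeEdges nothing nodeP s1 R (r ∷ P))
        ≡ treeEdges nothing nodeP s2 Q (r ∷ P) ++ treeEdges nothing nodeP s2 R (l ∷ P)
    swapped-subtrees s1 s2 sl sr = trans (mapEdges-++ g (treeEdges nothing nodeP s1 Q (l ∷ P)) _)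
      (cong₂ _++_ (treeEdges-move nothing s1 s2 g Q _ _ g-left sl (fixes-leaves Gg))
                  (treeEdges-move nothing s1 s2 g R _ _ g-right sr (fixes-leaves Gg)))

  tensor-comm-correct : AllSwitchingsTrees (plug C (Q ⊗ R)) Γ → AllSwitchingsTrees (plug C (R ⊗ Q)) Γ
  tensor-comm-correct H s2 = unsplit-graph C Γ s2 inner⊗
    (transfer-rename C Γ (Q ⊗ R) (R ⊗ Q) s1 s2 g Gg agree g-injective edges swapped-verts
      (split-graph C Γ s1 inner⊗ (H s1)))
    where
    s1 : Switching
    s1 = s2 ∘ g
    agree : AgreeOutside P s1 s2
    agree = (λ y o → cong s2 (fixes-outside Gg y (outside⇒notProperlyBelow o))) , (λ _ _ → refl)
    edges : mapEdges g (treeEdges nothing nodeP s1 (Q ⊗ R) P) ↭ treeEdges nothing nodeP s2 (R ⊗ Q) P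
    edges = ↭-trans
      (↭-reflexive (cong₂ _∷_ (cong₂ _,_ g-rQ (local-root Gg)) (cong₂ _∷_ (cong₂ _,_ g-rR (local-root Gg))
        (swapped-subtrees s1 s2 (cong s2 ∘ g-left) (cong s2 ∘ g-right)))))
      (swap _ _ (++-comm (treeEdges nothing nodeP s2 Q (r ∷ P)) _))

  -- The switching at the root is flipped, so that the same child edge is deleted in both graphs.
  par-comm-correct : AllSwitchingsTrees (plug C (Q ⅋ R)) Γ → AllSwitchingsTrees (plug C (R ⅋ Q)) Γ
  par-comm-correct H s2 = unsplit-graph C Γ s2 inner⅋
    (transfer-rename C Γ (Q ⅋ R) (R ⅋ Q) s1 s2 g Gg agree g-injective edges swapped-verts
      (split-graph C Γ s1 inner⅋ (H s1)))
    where
    d = s2 (nodeP P)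
    s1 : Switching
    s1 = override (nodeP P) (flipDir d) (s2 ∘ g)
    s1-below : ∀ y e → s1 (nodeP (y ++ e ∷ P)) ≡ s2 (g (nodeP (y ++ e ∷ P)))
    s1-below y e = override-other (nodeP P) (flipDir d) _ _ (λ eq → below≢ y e P (nodeP-inj eq))
    agree : AgreeOutside P s1 s2
    agree = (λ y o → trans (override-other (nodeP P) (flipDir d) _ (nodeP y) (λ e → o [] (nodeP-inj e)))
                           (cong s2 (fixes-outside Gg y (outside⇒notProperlyBelow o)))) , (λ _ _ → refl)
    tQ = treeEdges nothing nodeP s2 Q (r ∷ P)
    tR = treeEdges nothing nodeP s2 R (l ∷ P)
    root-edges : ∀ e →
      pick (flipDir e) ((g (rootV nodeP R (r ∷ P)) , g (nodeP P)) ∷ [])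
          ((g (rootV nodeP Q (l ∷ P)) , g (nodeP P)) ∷ [])
        ++ tQ ++ tR ↭ pick e ((rQ , nodeP P) ∷ []) ((rR , nodeP P) ∷ []) ++ tR ++ tQ
    root-edges l rewrite g-rQ | local-root Gg = prep _ (++-comm tQ tR)
    root-edges r rewrite g-rR | local-root Gg = prep _ (++-comm tQ tR)
    edges : mapEdges g (treeEdges nothing nodeP s1 (Q ⅋ R) P) ↭ treeEdges nothing nodeP s2 (R ⅋ Q) P
    edges rewrite treeEdges-⅋ nothing nodeP s1 Q R P | override-self (nodeP P) (flipDir d) (s2 ∘ g)
                | treeEdges-⅋ nothing nodeP s2 R Q P =
      ↭-trans (↭-reflexive (trans (mapEdges-++ g (pick (flipDir d) _ _) _)
                (cong₂ _++_ (mapEdges-pick g (flipDir d) _ _)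
                  (swapped-subtrees s1 s2 (λ y → trans (s1-below y l) (cong s2 (g-left y)))
                                          (λ y → trans (s1-below y r) (cong s2 (g-right y)))))))
        (root-edges d)

swapTop₂ : Path → Path
swapTop₂ (d ∷ e ∷ w) = e ∷ d ∷ w
swapTop₂ w = w

swapTop₂-involutive : ∀ a → swapTop₂ (swapTop₂ a) ≡ a
swapTop₂-involutive [] = refl
swapTop₂-involutive (_ ∷ []) = refl
swapTop₂-involutive (_ ∷ _ ∷ _) = refl


-- Contracting the inner ⊗-edge of ⊥ᵢ ⊗ (Q ⊗ ⊥ⱼ) or of (⊥ᵢ ⊗ Q) ⊗ ⊥ⱼ leaves the same star of ⊥ᵢ, Q and ⊥ⱼ.
module _ {A : Set} (C : Ctx A) (Γ : Sequent A) where

  private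
    P = holePath C []

  bot-assoc-correct : ∀ i (Q : Tree A) j → AllSwitchingsTrees (plug C (leaf (bot , i) ⊗ (Q ⊗ leaf (bot , j)))) Γ →
    AllSwitchingsTrees (plug C ((leaf (bot , i) ⊗ Q) ⊗ leaf (bot , j))) Γ
  bot-assoc-correct i Q j H s2 = unsplit-graph C Γ s2 inner⊗
    (transfer-contract-expand C Γ T1 T2 s1 s2 g h K1 M1 L1 M2 L2 inner2 root g-local h-local agree g-collapses
        g-fibre (λ e → root≢child P l (sym e))
       (sym (merge-collapses inner2 root (root≢child P l))) (λ x y e → reach-flip (merge-fibre inner2 root x y e))
       (swap _ _ ↭-refl) ↭-refl g-L1↭h-L2 verts-⊆ (split-graph C Γ s1 inner⊗ (H s1)))
    where
    T1 = leaf (bot , i) ⊗ (Q ⊗ leaf (bot , j))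
    T2 = (leaf (bot , i) ⊗ Q) ⊗ leaf (bot , j)
    root = nodeP P
    inner1 = nodeP (r ∷ P)
    inner2 = nodeP (l ∷ P)
    F = relocate P swapTop₂
    g : Vertex → Vertex
    g v = F (merge inner1 root v)
    g-local : Local P g
    g-local = local-∘ (merge-child-local P r root) (relocate-local P swapTop₂ refl)
    g-collapses : ∀ {a b} → (a , b) ∈ (inner1 , root) ∷ [] → g a ≡ g b
    g-collapses (here refl) = cong F (sym (merge-collapses inner1 root (root≢child P r)))
    g-fibre : ∀ x y → g x ≡ g y → Reach ((inner1 , root) ∷ []) x y
    g-fibre x y e = reach-flip (merge-fibre inner1 root x y
        (relocate-injective P swapTop₂ (inverse⇒injective swapTop₂ swapTop₂-involutive) _ _ e))
    s1 : Switching
    s1 v = s2 (g v)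
    agree : AgreeOutside P s1 s2
    agree = (λ y o → cong s2 (fixes-outside g-local y (outside⇒notProperlyBelow o))) , (λ k q → refl)
    h = merge inner2 root
    h-local = merge-child-local P l root
    K1 = (inner1 , root) ∷ []
    M1 = treeEdges nothing nodeP s1 T1 P
    tQ1 = treeEdges nothing nodeP s1 Q (l ∷ r ∷ P)
    tQ2 = treeEdges nothing nodeP s2 Q (r ∷ l ∷ P)
    rQ1 = rootV nodeP Q (l ∷ r ∷ P)
    rQ2 = rootV nodeP Q (r ∷ l ∷ P)
    L1 = (leafV i , root) ∷ (rQ1 , inner1) ∷ (leafV j , inner1) ∷ (tQ1 ++ [])
    M2 = treeEdges nothing nodeP s2 T2 P
    L2 = (leafV j , root) ∷ (((leafV i , inner2) ∷ (rQ2 , inner2) ∷ tQ2) ++ [])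
    g-Q : ∀ y → g (nodeP (y ++ l ∷ r ∷ P)) ≡ nodeP (y ++ r ∷ l ∷ P)
    g-Q y = trans (cong F (merge-other inner1 root _ (nodeP-≢ (below≢ y l (r ∷ P)))))
        (relocate-below P swapTop₂ (r ∷ l ∷ []) (l ∷ r ∷ []) (λ w → refl) y)
    h-Q : ∀ y → h (nodeP (y ++ r ∷ l ∷ P)) ≡ nodeP (y ++ r ∷ l ∷ P)
    h-Q y = merge-other inner2 root _ (nodeP-≢ (below≢ y r (l ∷ P)))
    g-root : g root ≡ root
    g-root = local-root g-local
    g-inner : g inner1 ≡ root
    g-inner = trans (cong F (merge-self inner1 root)) (local-root (relocate-local P swapTop₂ refl))
    h-root : h root ≡ root
    h-root = local-root h-local
    h-inner : h inner2 ≡ root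
    h-inner = merge-self inner2 root
    g-subtree : mapEdges g tQ1 ≡ tQ2
    g-subtree = treeEdges-move nothing s1 s2 g Q _ _ g-Q (λ y → cong s2 (g-Q y)) (fixes-leaves g-local)
    h-subtree : mapEdges h tQ2 ≡ tQ2
    h-subtree = treeEdges-move nothing s2 s2 h Q _ _ h-Q (λ y → refl) (fixes-leaves h-local)
    g-L1 : mapEdges g L1 ≡ (leafV i , nodeP P) ∷ (rQ2 , nodeP P) ∷ (leafV j , nodeP P) ∷ tQ2
    g-L1 = cong₂ _∷_ (cong₂ _,_ refl g-root) (cong₂ _∷_
        (cong₂ _,_ (rootV-move g Q _ _ (g-Q []) (fixes-leaves g-local)) g-inner)
           (cong₂ _∷_ (cong₂ _,_ refl g-inner) (trans (cong (mapEdges g) (LP.++-identityʳ tQ1)) g-subtree)))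
    h-L2 : mapEdges h L2 ≡ (leafV j , nodeP P) ∷ (leafV i , nodeP P) ∷ (rQ2 , nodeP P) ∷ tQ2
    h-L2 = cong₂ _∷_ (cong₂ _,_ refl h-root) (trans
        (cong (mapEdges h) (LP.++-identityʳ ((leafV i , inner2) ∷ (rQ2 , inner2) ∷ tQ2)))
           (cong₂ _∷_ (cong₂ _,_ refl h-inner) (cong₂ _∷_
               (cong₂ _,_ (rootV-move h Q _ _ (h-Q []) (fixes-leaves h-local)) h-inner) h-subtree)))
    g-L1↭h-L2 : mapEdges g L1 ↭ mapEdges h L2
    g-L1↭h-L2 = ↭-trans (↭-reflexive g-L1) (↭-trans (shift _ ((leafV i , nodeP P) ∷ (rQ2 , nodeP P) ∷ []) tQ2)
        (↭-reflexive (sym h-L2)))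
    vQ1 = treeVerts nodeP Q (l ∷ r ∷ P)
    vQ2 = treeVerts nodeP Q (r ∷ l ∷ P)
    verts-⊆ : map h (treeVerts nodeP T2 P) ⊆ map g (treeVerts nodeP T1 P)
    verts-⊆ = subst₂ _⊆_
           (sym (cong₂ _∷_ h-root (cong₂ _∷_ h-inner (cong (leafV i ∷_)
             (trans (LP.map-++ h vQ2 _) (cong (_++ (leafV j ∷ []))
                 (treeVerts-move h Q _ _ h-Q (fixes-leaves h-local))))))))
           (sym (cong₂ _∷_ g-root (cong (leafV i ∷_) (cong₂ _∷_ g-inner
             (trans (LP.map-++ g vQ1 _) (cong (_++ (leafV j ∷ []))
                 (treeVerts-move g Q _ _ g-Q (fixes-leaves g-local))))))))
           swap-front
      where
      swap-front : (nodeP P ∷ nodeP P ∷ leafV i ∷ (vQ2 ++ leafV j ∷ [])) ⊆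
          (nodeP P ∷ leafV i ∷ nodeP P ∷ (vQ2 ++ leafV j ∷ []))
      swap-front (here e) = here e
      swap-front (there (here e)) = here e
      swap-front (there (there (here e))) = there (here e)
      swap-front (there (there (there m))) = there (there (there m))

assocʳ : Path → Path
assocʳ [] = []
assocʳ (l ∷ []) = r ∷ []
assocʳ (l ∷ l ∷ w) = l ∷ w
assocʳ (l ∷ r ∷ w) = r ∷ l ∷ w
assocʳ (r ∷ w) = r ∷ r ∷ w

assocˡ : Path → Path
assocˡ [] = []
assocˡ (l ∷ w) = l ∷ l ∷ w
assocˡ (r ∷ []) = l ∷ []
assocˡ (r ∷ l ∷ w) = l ∷ r ∷ w
assocˡ (r ∷ r ∷ w) = r ∷ w

assocˡ-assocʳ : ∀ a → assocˡ (assocʳ a) ≡ a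
assocˡ-assocʳ [] = refl
assocˡ-assocʳ (l ∷ []) = refl
assocˡ-assocʳ (l ∷ l ∷ a) = refl
assocˡ-assocʳ (l ∷ r ∷ a) = refl
assocˡ-assocʳ (r ∷ a) = refl

assocʳ-assocˡ : ∀ a → assocʳ (assocˡ a) ≡ a
assocʳ-assocˡ [] = refl
assocʳ-assocˡ (l ∷ a) = refl
assocʳ-assocˡ (r ∷ []) = refl
assocʳ-assocˡ (r ∷ l ∷ a) = refl
assocʳ-assocˡ (r ∷ r ∷ a) = refl


below₂≢ : ∀ y d e q → y ++ d ∷ e ∷ q ≢ q
below₂≢ y d e q eq = below≢ (y ++ d ∷ []) e q (trans (LP.++-assoc y (d ∷ []) (e ∷ q)) eq)

beside≢ : ∀ y d e q → d ≢ e → y ++ d ∷ q ≢ e ∷ q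
beside≢ y d e q ne eq = ne (branch-injective y [] d e q eq)

rootV∈treeVerts : ∀ {A} (T : Tree A) q → rootV nodeP T q ∈ treeVerts nodeP T q
rootV∈treeVerts (leaf x) q = here refl
rootV∈treeVerts (_ ⊗ _) q = here refl
rootV∈treeVerts (_ ⅋ _) q = here refl

rootV≢ : ∀ {A} (T : Tree A) q w → (nodeP q ≢ w) → (∀ i → leafV i ≢ w) → rootV nodeP T q ≢ w
rootV≢ (leaf (_ , i)) q w h1 h2 = h2 i
rootV≢ (_ ⊗ _) q w h1 h2 = h1
rootV≢ (_ ⅋ _) q w h1 h2 = h1

⊆-add-first : ∀ (v x : Vertex) (A B D : List Vertex) → (v ∷ A ++ B ++ D) ⊆ (v ∷ (x ∷ A ++ B) ++ D)
⊆-add-first v x A B D (here e) = here e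
⊆-add-first v x A B D (there m) with ∈-++⁻ A m
... | inj₁ ma = there (there (∈-++⁺ˡ (∈-++⁺ˡ ma)))
... | inj₂ m' with ∈-++⁻ B m'
...   | inj₁ mb = there (there (∈-++⁺ˡ (∈-++⁺ʳ A mb)))
...   | inj₂ md = there (there (∈-++⁺ʳ (A ++ B) md))

⊆-remove-mid : ∀ (v x : Vertex) (A B D : List Vertex) → x ∈ v ∷ A ++ B ++ D →
  (v ∷ A ++ (x ∷ B ++ D)) ⊆ (v ∷ A ++ B ++ D)
⊆-remove-mid v x A B D mx (here e) = here e
⊆-remove-mid v x A B D mx (there m) with ∈-++⁻ A m
... | inj₁ ma = there (∈-++⁺ˡ ma)
... | inj₂ (here refl) = mx
... | inj₂ (there m') = there (∈-++⁺ʳ A m')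

module ParAssoc {A : Set} (C : Ctx A) (Γ : Sequent A) (Q R S : Tree A) (s2 : Switching) where
  P = holePath C []
  T1 = (Q ⅋ R) ⅋ S
  T2 = Q ⅋ (R ⅋ S)
  F = relocate P assocʳ
  F-local = relocate-local P assocʳ refl
  root = nodeP P
  inner2 = nodeP (r ∷ P)
  inner1 = nodeP (l ∷ P)
  tQ2 = treeEdges nothing nodeP s2 Q (l ∷ P)
  tR2 = treeEdges nothing nodeP s2 R (l ∷ r ∷ P)
  tS2 = treeEdges nothing nodeP s2 S (r ∷ r ∷ P)
  rQ2 = rootV nodeP Q (l ∷ P)
  rR2 = rootV nodeP R (l ∷ r ∷ P)
  rS2 = rootV nodeP S (r ∷ r ∷ P)
  vQ2 = treeVerts nodeP Q (l ∷ P)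
  vR2 = treeVerts nodeP R (l ∷ r ∷ P)
  vS2 = treeVerts nodeP S (r ∷ r ∷ P)
  star : Vertex → List Edge
  star X = (X , nodeP P) ∷ tQ2 ++ tR2 ++ tS2
  starVerts : List Vertex
  starVerts = nodeP P ∷ vQ2 ++ vR2 ++ vS2
  B2 = outerEdges nothing s2 C Γ
  M2 = treeEdges nothing nodeP s2 T2 P

  F-Q : ∀ y → F (nodeP (y ++ l ∷ l ∷ P)) ≡ nodeP (y ++ l ∷ P)
  F-Q = relocate-below P assocʳ (l ∷ l ∷ []) (l ∷ []) (λ w → refl)
  F-R : ∀ y → F (nodeP (y ++ r ∷ l ∷ P)) ≡ nodeP (y ++ l ∷ r ∷ P)
  F-R = relocate-below P assocʳ (l ∷ r ∷ []) (r ∷ l ∷ []) (λ w → refl)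
  F-S : ∀ y → F (nodeP (y ++ r ∷ P)) ≡ nodeP (y ++ r ∷ r ∷ P)
  F-S = relocate-below P assocʳ (r ∷ []) (r ∷ r ∷ []) (λ w → refl)

  module Source (e1 e2 : Dir) (u : Vertex) (merge-u-local : Local P (merge inner1 u)) where
    s1 : Switching
    s1 = override root e1 (override inner1 e2 (λ v → s2 (F v)))
    σ = merge inner1 u
    g : Vertex → Vertex
    g v = F (σ v)
    g-local : Local P g
    g-local = local-∘ merge-u-local F-local
    s1-elsewhere : ∀ v → v ≢ root → v ≢ inner1 → s1 v ≡ s2 (F v)
    s1-elsewhere v a b = trans (override-other root e1 _ v a) (override-other inner1 e2 _ v b)
    agree : AgreeOutside P s1 s2
    agree = (λ y o → trans (s1-elsewhere (nodeP y) (λ e → o [] (nodeP-inj e)) (λ e → o (l ∷ []) (nodeP-inj e)))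
                         (cong s2 (fixes-outside F-local y (outside⇒notProperlyBelow o)))) , (λ k q → refl)
    tQ1 = treeEdges nothing nodeP s1 Q (l ∷ l ∷ P)
    tR1 = treeEdges nothing nodeP s1 R (r ∷ l ∷ P)
    tS1 = treeEdges nothing nodeP s1 S (r ∷ P)
    rQ1 = rootV nodeP Q (l ∷ l ∷ P)
    rR1 = rootV nodeP R (r ∷ l ∷ P)
    rS1 = rootV nodeP S (r ∷ P)
    vQ1 = treeVerts nodeP Q (l ∷ l ∷ P)
    vR1 = treeVerts nodeP R (r ∷ l ∷ P)
    vS1 = treeVerts nodeP S (r ∷ P)
    M1 = treeEdges nothing nodeP s1 T1 P
    T1-edges : M1 ≡ pick e1 ((rS1 , root) ∷ []) ((inner1 , root) ∷ []) ++
        (pick e2 ((rR1 , inner1) ∷ []) ((rQ1 , inner1) ∷ []) ++ tQ1 ++ tR1) ++ tS1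
    T1-edges rewrite treeEdges-⅋ nothing nodeP s1 (Q ⅋ R) S P | treeEdges-⅋ nothing nodeP s1 Q R (l ∷ P)
      | override-self root e1 (override inner1 e2 (λ v → s2 (F v))) | override-other root e1
          (override inner1 e2 (λ v → s2 (F v))) inner1 (λ e → root≢child P l (sym e))
      | override-self inner1 e2 (λ v → s2 (F v)) = refl
    g-Q : ∀ y → g (nodeP (y ++ l ∷ l ∷ P)) ≡ nodeP (y ++ l ∷ P)
    g-Q y = trans (cong F (merge-other inner1 u _ (nodeP-≢ (below≢ y l (l ∷ P))))) (F-Q y)
    g-R : ∀ y → g (nodeP (y ++ r ∷ l ∷ P)) ≡ nodeP (y ++ l ∷ r ∷ P)
    g-R y = trans (cong F (merge-other inner1 u _ (nodeP-≢ (below≢ y r (l ∷ P))))) (F-R y)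
    g-S : ∀ y → g (nodeP (y ++ r ∷ P)) ≡ nodeP (y ++ r ∷ r ∷ P)
    g-S y = trans (cong F (merge-other inner1 u _ (nodeP-≢ (beside≢ y r l P (λ ()))))) (F-S y)
    s1-Q : ∀ y → s1 (nodeP (y ++ l ∷ l ∷ P)) ≡ s2 (nodeP (y ++ l ∷ P))
    s1-Q y = trans (s1-elsewhere _ (nodeP-≢ (below₂≢ y l l P)) (nodeP-≢ (below≢ y l (l ∷ P)))) (cong s2 (F-Q y))
    s1-R : ∀ y → s1 (nodeP (y ++ r ∷ l ∷ P)) ≡ s2 (nodeP (y ++ l ∷ r ∷ P))
    s1-R y = trans (s1-elsewhere _ (nodeP-≢ (below₂≢ y r l P)) (nodeP-≢ (below≢ y r (l ∷ P)))) (cong s2 (F-R y))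
    s1-S : ∀ y → s1 (nodeP (y ++ r ∷ P)) ≡ s2 (nodeP (y ++ r ∷ r ∷ P))
    s1-S y = trans (s1-elsewhere _ (nodeP-≢ (below≢ y r P)) (nodeP-≢ (beside≢ y r l P (λ ())))) (cong s2 (F-S y))
    g-subtrees : mapEdges g (tQ1 ++ tR1 ++ tS1) ≡ tQ2 ++ tR2 ++ tS2
    g-subtrees = trans (mapEdges-++ g tQ1 _) (cong₂ _++_
        (treeEdges-move nothing s1 s2 g Q _ _ g-Q s1-Q (fixes-leaves g-local))
           (trans (mapEdges-++ g tR1 _) (cong₂ _++_
               (treeEdges-move nothing s1 s2 g R _ _ g-R s1-R (fixes-leaves g-local))
                   (treeEdges-move nothing s1 s2 g S _ _ g-S s1-S (fixes-leaves g-local)))))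
    g-rQ : g rQ1 ≡ rQ2
    g-rQ = rootV-move g Q _ _ (g-Q []) (fixes-leaves g-local)
    g-rR : g rR1 ≡ rR2
    g-rR = rootV-move g R _ _ (g-R []) (fixes-leaves g-local)
    g-rS : g rS1 ≡ rS2
    g-rS = rootV-move g S _ _ (g-S []) (fixes-leaves g-local)
    g-root : g root ≡ nodeP P
    g-root = local-root g-local
    g-verts : map g (treeVerts nodeP T1 P) ≡ nodeP P ∷ (g inner1 ∷ vQ2 ++ vR2) ++ vS2
    g-verts = cong₂ _∷_ g-root (trans (LP.map-++ g (inner1 ∷ vQ1 ++ vR1) vS1) (cong₂ _++_
           (cong (g inner1 ∷_) (trans (LP.map-++ g vQ1 vR1)
               (cong₂ _++_ (treeVerts-move g Q _ _ g-Q (fixes-leaves g-local))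
                   (treeVerts-move g R _ _ g-R (fixes-leaves g-local)))))
           (treeVerts-move g S _ _ g-S (fixes-leaves g-local))))
    starVerts-⊆ : starVerts ⊆ map g (treeVerts nodeP T1 P)
    starVerts-⊆ {x} m = subst (x ∈_) (sym g-verts) (⊆-add-first (nodeP P) (g inner1) vQ2 vR2 vS2 m)

  source-star-S : AllSwitchingsTrees (plug C T1) Γ → SpanningTree (B2 ++ star rS2) (outerVerts C Γ ++ starVerts)
  source-star-S H = transfer-contract C Γ T1 s1 s2 g ((rQ1 , inner1) ∷ []) M1 L1 (star rS2) starVerts g-local agree
      col fib pM1 pL starVerts-⊆
             (split-graph C Γ s1 inner⅋ (H s1))
    where
    nQ : rootV nodeP Q (l ∷ l ∷ P) ≢ inner1
    nQ = rootV≢ Q _ _ (nodeP-≢ (below≢ [] l (l ∷ P))) (λ i ())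
    open Source l r (rootV nodeP Q (l ∷ l ∷ P)) (merge-child-local P l _)
    L1 = (rS1 , root) ∷ tQ1 ++ tR1 ++ tS1
    col : ∀ {a b} → (a , b) ∈ (rQ1 , inner1) ∷ [] → g a ≡ g b
    col (here refl) = cong F (merge-collapses inner1 rQ1 nQ)
    fib : ∀ x y → g x ≡ g y → Reach ((rQ1 , inner1) ∷ []) x y
    fib x y e = merge-fibre inner1 rQ1 x y (relocate-injective P assocʳ (inverse⇒injective assocˡ assocˡ-assocʳ) _ _ e)
    pM1 : M1 ↭ ((rQ1 , inner1) ∷ []) ++ L1
    pM1 rewrite T1-edges = swap _ _ (↭-reflexive (LP.++-assoc tQ1 tR1 tS1))
    pL : mapEdges g L1 ↭ star rS2
    pL = ↭-reflexive (cong₂ _∷_ (cong₂ _,_ g-rS g-root) g-subtrees)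

  inner1≢root : root ≢ inner1
  inner1≢root e = root≢child P l e

  source-star-R : AllSwitchingsTrees (plug C T1) Γ → SpanningTree (B2 ++ star rR2) (outerVerts C Γ ++ starVerts)
  source-star-R H = transfer-contract C Γ T1 s1 s2 g ((inner1 , root) ∷ []) M1 L1 (star rR2) starVerts g-local
      agree col fib pM1 pL starVerts-⊆
             (split-graph C Γ s1 inner⅋ (H s1))
    where
    open Source r l root (merge-child-local P l root)
    L1 = (rR1 , inner1) ∷ tQ1 ++ tR1 ++ tS1
    col : ∀ {a b} → (a , b) ∈ (inner1 , root) ∷ [] → g a ≡ g b
    col (here refl) = cong F (sym (merge-collapses inner1 root inner1≢root))
    fib : ∀ x y → g x ≡ g y → Reach ((inner1 , root) ∷ []) x y
    fib x y e = reach-flip (merge-fibre inner1 root x y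
        (relocate-injective P assocʳ (inverse⇒injective assocˡ assocˡ-assocʳ) _ _ e))
    pM1 : M1 ↭ ((inner1 , root) ∷ []) ++ L1
    pM1 rewrite T1-edges = prep _ (prep _ (↭-reflexive (LP.++-assoc tQ1 tR1 tS1)))
    g-inner1 : g inner1 ≡ nodeP P
    g-inner1 = trans (cong F (merge-self inner1 root)) (local-root F-local)
    pL : mapEdges g L1 ↭ star rR2
    pL = ↭-reflexive (cong₂ _∷_ (cong₂ _,_ g-rR g-inner1) g-subtrees)

  source-star-Q : AllSwitchingsTrees (plug C T1) Γ → SpanningTree (B2 ++ star rQ2) (outerVerts C Γ ++ starVerts)
  source-star-Q H = transfer-contract C Γ T1 s1 s2 g ((inner1 , root) ∷ []) M1 L1 (star rQ2) starVerts g-local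
      agree col fib pM1 pL starVerts-⊆
             (split-graph C Γ s1 inner⅋ (H s1))
    where
    open Source r r root (merge-child-local P l root)
    L1 = (rQ1 , inner1) ∷ tQ1 ++ tR1 ++ tS1
    col : ∀ {a b} → (a , b) ∈ (inner1 , root) ∷ [] → g a ≡ g b
    col (here refl) = cong F (sym (merge-collapses inner1 root inner1≢root))
    fib : ∀ x y → g x ≡ g y → Reach ((inner1 , root) ∷ []) x y
    fib x y e = reach-flip (merge-fibre inner1 root x y
        (relocate-injective P assocʳ (inverse⇒injective assocˡ assocˡ-assocʳ) _ _ e))
    pM1 : M1 ↭ ((inner1 , root) ∷ []) ++ L1
    pM1 rewrite T1-edges = prep _ (prep _ (↭-reflexive (LP.++-assoc tQ1 tR1 tS1)))
    g-inner1 : g inner1 ≡ nodeP P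
    g-inner1 = trans (cong F (merge-self inner1 root)) (local-root F-local)
    pL : mapEdges g L1 ↭ star rQ2
    pL = ↭-reflexive (cong₂ _∷_ (cong₂ _,_ g-rQ g-inner1) g-subtrees)

  T2-edges : M2 ≡ pick (s2 root) ((inner2 , root) ∷ []) ((rQ2 , root) ∷ []) ++ tQ2 ++
      (pick (s2 inner2) ((rS2 , inner2) ∷ []) ((rR2 , inner2) ∷ []) ++ tR2 ++ tS2)
  T2-edges rewrite treeEdges-⅋ nothing nodeP s2 Q (R ⅋ S) P | treeEdges-⅋ nothing nodeP s2 R S (r ∷ P) = refl

  module Target (u : Vertex) (merge-u-local : Local P (merge inner2 u)) where
    h = merge inner2 u
    h-Q : ∀ y → h (nodeP (y ++ l ∷ P)) ≡ nodeP (y ++ l ∷ P)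
    h-Q y = merge-other inner2 u _ (nodeP-≢ (beside≢ y l r P (λ ())))
    h-R : ∀ y → h (nodeP (y ++ l ∷ r ∷ P)) ≡ nodeP (y ++ l ∷ r ∷ P)
    h-R y = merge-other inner2 u _ (nodeP-≢ (below≢ y l (r ∷ P)))
    h-S : ∀ y → h (nodeP (y ++ r ∷ r ∷ P)) ≡ nodeP (y ++ r ∷ r ∷ P)
    h-S y = merge-other inner2 u _ (nodeP-≢ (below≢ y r (r ∷ P)))
    g-subtrees : mapEdges h (tQ2 ++ tR2 ++ tS2) ≡ tQ2 ++ tR2 ++ tS2
    g-subtrees = trans (mapEdges-++ h tQ2 _) (cong₂ _++_
        (treeEdges-move nothing s2 s2 h Q _ _ h-Q (λ y → refl) (fixes-leaves merge-u-local))
           (trans (mapEdges-++ h tR2 _) (cong₂ _++_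
               (treeEdges-move nothing s2 s2 h R _ _ h-R (λ y → refl) (fixes-leaves merge-u-local))
             (treeEdges-move nothing s2 s2 h S _ _ h-S (λ y → refl) (fixes-leaves merge-u-local)))))
    h-rQ : h rQ2 ≡ rQ2
    h-rQ = rootV-move h Q _ _ (h-Q []) (fixes-leaves merge-u-local)
    h-rR : h rR2 ≡ rR2
    h-rR = rootV-move h R _ _ (h-R []) (fixes-leaves merge-u-local)
    h-root : h root ≡ nodeP P
    h-root = local-root merge-u-local
    g-verts : map h (treeVerts nodeP T2 P) ≡ nodeP P ∷ vQ2 ++ (h inner2 ∷ vR2 ++ vS2)
    g-verts = cong₂ _∷_ h-root (trans (LP.map-++ h vQ2 _)
        (cong₂ _++_ (treeVerts-move h Q _ _ h-Q (fixes-leaves merge-u-local))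
           (cong (h inner2 ∷_) (trans (LP.map-++ h vR2 _)
               (cong₂ _++_ (treeVerts-move h R _ _ h-R (fixes-leaves merge-u-local))
                   (treeVerts-move h S _ _ h-S (fixes-leaves merge-u-local)))))))
    verts-⊆starVerts : h inner2 ∈ starVerts → map h (treeVerts nodeP T2 P) ⊆ starVerts
    verts-⊆starVerts mm {x} m = ⊆-remove-mid (nodeP P) (h inner2) vQ2 vR2 vS2 mm (subst (x ∈_) g-verts m)

  inner2≢root : inner2 ≢ root
  inner2≢root e = root≢child P r (sym e)

  target-via-inner : ∀ (X : Vertex) → merge inner2 root X ≡ X → s2 root ≡ l →
      pick (s2 inner2) ((rS2 , inner2) ∷ []) ((rR2 , inner2) ∷ []) ≡ (X , inner2) ∷ [] →
    SpanningTree (B2 ++ star X) (outerVerts C Γ ++ starVerts) → SpanningTree (B2 ++ M2) (verts (plug C T2) Γ)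
  target-via-inner X hX e1 e2 t = transfer-expand C Γ T2 s2 h inner2 root M2 L2 (star X) starVerts
      (merge-child-local P r root) inner2≢root (sym (merge-collapses inner2 root (root≢child P r)))
      (λ x y e → reach-flip (merge-fibre inner2 root x y e)) pM2 pL
          (verts-⊆starVerts (subst (_∈ starVerts) (sym (merge-self inner2 root)) (here refl))) t
    where
    open Target root (merge-child-local P r root)
    L2 = (X , inner2) ∷ tQ2 ++ tR2 ++ tS2
    pM2 : M2 ↭ (inner2 , root) ∷ L2
    pM2 rewrite T2-edges | e1 | e2 = prep _ (shift _ tQ2 _)
    pL : mapEdges h L2 ↭ star X
    pL = ↭-reflexive (cong₂ _∷_ (cong₂ _,_ hX (merge-self inner2 root)) g-subtrees)

  target-via-Q : ∀ (Y : Vertex) → s2 root ≡ r → pick (s2 inner2) ((rS2 , inner2) ∷ []) ((rR2 , inner2) ∷ []) ≡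
      (Y , inner2) ∷ [] →
    Y ≢ inner2 → Local P (merge inner2 Y) → Y ∈ starVerts →
    SpanningTree (B2 ++ star rQ2) (outerVerts C Γ ++ starVerts) → SpanningTree (B2 ++ M2) (verts (plug C T2) Γ)
  target-via-Q Y e1 e2 nY GY mY t = transfer-expand C Γ T2 s2 h Y inner2 M2 L2 (star rQ2) starVerts GY nY
      (merge-collapses inner2 Y nY)
      (merge-fibre inner2 Y) pM2 pL (verts-⊆starVerts (subst (_∈ starVerts) (sym (merge-self inner2 Y)) mY)) t
    where
    open Target Y GY
    L2 = (rQ2 , root) ∷ tQ2 ++ tR2 ++ tS2
    pM2 : M2 ↭ (Y , inner2) ∷ L2
    pM2 rewrite T2-edges | e1 | e2 = shift _ ((rQ2 , root) ∷ tQ2) _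
    pL : mapEdges h L2 ↭ star rQ2
    pL = ↭-reflexive (cong₂ _∷_ (cong₂ _,_ h-rQ h-root) g-subtrees)

-- In each of the four cases for s₂ on T₂ = Q ⅋ (R ⅋ S), a switching of T₁ = (Q ⅋ R) ⅋ S and one
-- kept edge on each side are chosen such that contracting them yields the same star: the three
-- subtrees hanging off the root, exactly one of them joined to it.
par-assoc-correct : ∀ {A} (C : Ctx A) Γ (Q R S : Tree A) →
  AllSwitchingsTrees (plug C ((Q ⅋ R) ⅋ S)) Γ → AllSwitchingsTrees (plug C (Q ⅋ (R ⅋ S))) Γ
par-assoc-correct C Γ Q R S H s2 = unsplit-graph C Γ s2 inner⅋ (by-cases (s2 root) (s2 inner2) refl refl)
  where
  open ParAssoc C Γ Q R S s2
  kept : Dir → List Edge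
  kept d = pick d ((rS2 , inner2) ∷ []) ((rR2 , inner2) ∷ [])
  rS≢inner2 : rS2 ≢ inner2
  rS≢inner2 = rootV≢ S _ _ (nodeP-≢ (below≢ [] r (r ∷ P))) (λ _ ())
  rR≢inner2 : rR2 ≢ inner2
  rR≢inner2 = rootV≢ R _ _ (nodeP-≢ (below≢ [] l (r ∷ P))) (λ _ ())
  merge-fixes-rS : merge inner2 root rS2 ≡ rS2
  merge-fixes-rS = rootV-move (merge inner2 root) S _ _ (merge-other inner2 root _ (nodeP-≢ (below≢ [] r (r ∷ P))))
    (fixes-leaves (merge-child-local P r root))
  merge-fixes-rR : merge inner2 root rR2 ≡ rR2
  merge-fixes-rR = rootV-move (merge inner2 root) R _ _ (merge-other inner2 root _ (nodeP-≢ (below≢ [] l (r ∷ P))))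
    (fixes-leaves (merge-child-local P r root))
  rS∈starVerts : rS2 ∈ starVerts
  rS∈starVerts = there (∈-++⁺ʳ vQ2 (∈-++⁺ʳ vR2 (rootV∈treeVerts S _)))
  rR∈starVerts : rR2 ∈ starVerts
  rR∈starVerts = there (∈-++⁺ʳ vQ2 (∈-++⁺ˡ (rootV∈treeVerts R _)))
  by-cases : ∀ d1 d2 → s2 root ≡ d1 → s2 inner2 ≡ d2 → SpanningTree (B2 ++ M2) (verts (plug C T2) Γ)
  by-cases l l e1 e2 = target-via-inner rS2 merge-fixes-rS e1 (cong kept e2) (source-star-S H)
  by-cases l r e1 e2 = target-via-inner rR2 merge-fixes-rR e1 (cong kept e2) (source-star-R H)
  by-cases r l e1 e2 =
    target-via-Q rS2 e1 (cong kept e2) rS≢inner2 (merge-child-local P r rS2) rS∈starVerts (source-star-Q H)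
  by-cases r r e1 e2 =
    target-via-Q rR2 e1 (cong kept e2) rR≢inner2 (merge-child-local P r rR2) rR∈starVerts (source-star-Q H)

-- Extended switchings and the switch rule

names : ∀ {A} → Tree A → List ℕ
names T = map proj₂ (leaves T)

names-⊗ : ∀ {A} (t u : Tree A) → names (t ⊗ u) ≡ names t ++ names u
names-⊗ t u = LP.map-++ proj₂ (leaves t) (leaves u)

names-⅋ : ∀ {A} (t u : Tree A) → names (t ⅋ u) ≡ names t ++ names u
names-⅋ t u = LP.map-++ proj₂ (leaves t) (leaves u)

∉-++ˡ : ∀ {i} (X Y : List ℕ) → i ∉ X ++ Y → i ∉ X
∉-++ˡ X Y h m = h (∈-++⁺ˡ m)

∉-++ʳ : ∀ {i} (X Y : List ℕ) → i ∉ X ++ Y → i ∉ Y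
∉-++ʳ X Y h m = h (∈-++⁺ʳ X m)

childEdge-unextended : ∀ {A} i mk (T : Tree A) q v → i ∉ names T →
  childEdge (just i) mk T q v ≡ childEdge nothing mk T q v
childEdge-unextended i mk (leaf (_ , j)) q v h with i N.≟ j
... | yes refl = ⊥-elim (h (here refl))
... | no _ = refl
childEdge-unextended i mk (_ ⊗ _) q v h = refl
childEdge-unextended i mk (_ ⅋ _) q v h = refl

treeEdges-unextended : ∀ {A} i mk s (T : Tree A) q → i ∉ names T →
  treeEdges (just i) mk s T q ≡ treeEdges nothing mk s T q
treeEdges-unextended i mk s (leaf x) q h = refl
treeEdges-unextended i mk s (t ⊗ u) q h
  rewrite childEdge-unextended i mk t (l ∷ q) (mk q) (∉-++ˡ (names t) (names u) (subst (i ∉_) (names-⊗ t u) h))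
        | childEdge-unextended i mk u (r ∷ q) (mk q) (∉-++ʳ (names t) (names u) (subst (i ∉_) (names-⊗ t u) h))
        | treeEdges-unextended i mk s t (l ∷ q) (∉-++ˡ (names t) (names u) (subst (i ∉_) (names-⊗ t u) h))
        | treeEdges-unextended i mk s u (r ∷ q) (∉-++ʳ (names t) (names u) (subst (i ∉_) (names-⊗ t u) h)) = refl
treeEdges-unextended i mk s (t ⅋ u) q h
  rewrite treeEdges-⅋ (just i) mk s t u q | treeEdges-⅋ nothing mk s t u q
        | childEdge-unextended i mk t (l ∷ q) (mk q) (∉-++ˡ (names t) (names u) (subst (i ∉_) (names-⅋ t u) h))
        | childEdge-unextended i mk u (r ∷ q) (mk q) (∉-++ʳ (names t) (names u) (subst (i ∉_) (names-⅋ t u) h))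
        | treeEdges-unextended i mk s t (l ∷ q) (∉-++ˡ (names t) (names u) (subst (i ∉_) (names-⅋ t u) h))
        | treeEdges-unextended i mk s u (r ∷ q) (∉-++ʳ (names t) (names u) (subst (i ∉_) (names-⅋ t u) h)) = refl

childEdge-removed : ∀ {A} i mk (o : Lit A) q v → childEdge (just i) mk (leaf (o , i)) q v ≡ []
childEdge-removed i mk o q v with i N.≟ i
... | yes _ = refl
... | no ne = ⊥-elim (ne refl)

namesLeft : ∀ {A} → Ctx A → List ℕ
namesLeft hole = []
namesLeft (⊗ₗ C u) = namesLeft C
namesLeft (⊗ᵣ u C) = names u ++ namesLeft C
namesLeft (⅋ₗ C u) = namesLeft C
namesLeft (⅋ᵣ u C) = names u ++ namesLeft C

namesRight : ∀ {A} → Ctx A → List ℕ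
namesRight hole = []
namesRight (⊗ₗ C u) = namesRight C ++ names u
namesRight (⊗ᵣ u C) = namesRight C
namesRight (⅋ₗ C u) = namesRight C ++ names u
namesRight (⅋ᵣ u C) = namesRight C

names-plug : ∀ {A} (C : Ctx A) T → names (plug C T) ≡ namesLeft C ++ names T ++ namesRight C
names-plug hole T = sym (LP.++-identityʳ (names T))
names-plug (⊗ₗ C u) T = trans (names-⊗ (plug C T) u) (trans (cong (_++ names u) (names-plug C T))
  (trans (LP.++-assoc (namesLeft C) (names T ++ namesRight C) (names u))
      (cong (namesLeft C ++_) (LP.++-assoc (names T) (namesRight C) (names u)))))
names-plug (⊗ᵣ u C) T = trans (names-⊗ u (plug C T)) (trans (cong (names u ++_) (names-plug C T))
  (sym (LP.++-assoc (names u) (namesLeft C) (names T ++ namesRight C))))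
names-plug (⅋ₗ C u) T = trans (names-⅋ (plug C T) u) (trans (cong (_++ names u) (names-plug C T))
  (trans (LP.++-assoc (namesLeft C) (names T ++ namesRight C) (names u))
      (cong (namesLeft C ++_) (LP.++-assoc (names T) (namesRight C) (names u)))))
names-plug (⅋ᵣ u C) T = trans (names-⅋ u (plug C T)) (trans (cong (names u ++_) (names-plug C T))
  (sym (LP.++-assoc (names u) (namesLeft C) (names T ++ namesRight C))))

ctxEdges-unextended : ∀ {A} i s (C : Ctx A) acc → i ∉ namesLeft C → i ∉ namesRight C →
  ctxEdges (just i) s C acc ≡ ctxEdges nothing s C acc
ctxEdges-unextended i s hole acc hl hr = refl
ctxEdges-unextended i s (⊗ₗ C u) acc hl hr
  rewrite childEdge-unextended i nodeP u (r ∷ acc) (nodeP acc) (∉-++ʳ (namesRight C) (names u) hr)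
        | treeEdges-unextended i nodeP s u (r ∷ acc) (∉-++ʳ (namesRight C) (names u) hr)
        | ctxEdges-unextended i s C (l ∷ acc) hl (∉-++ˡ (namesRight C) (names u) hr) = refl
ctxEdges-unextended i s (⊗ᵣ u C) acc hl hr
  rewrite childEdge-unextended i nodeP u (l ∷ acc) (nodeP acc) (∉-++ˡ (names u) (namesLeft C) hl)
        | treeEdges-unextended i nodeP s u (l ∷ acc) (∉-++ˡ (names u) (namesLeft C) hl)
        | ctxEdges-unextended i s C (r ∷ acc) (∉-++ʳ (names u) (namesLeft C) hl) hr = refl
ctxEdges-unextended i s (⅋ₗ C u) acc hl hr
  rewrite childEdge-unextended i nodeP u (r ∷ acc) (nodeP acc) (∉-++ʳ (namesRight C) (names u) hr)
        | treeEdges-unextended i nodeP s u (r ∷ acc) (∉-++ʳ (namesRight C) (names u) hr)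
        | ctxEdges-unextended i s C (l ∷ acc) hl (∉-++ˡ (namesRight C) (names u) hr) = refl
ctxEdges-unextended i s (⅋ᵣ u C) acc hl hr
  rewrite childEdge-unextended i nodeP u (l ∷ acc) (nodeP acc) (∉-++ˡ (names u) (namesLeft C) hl)
        | treeEdges-unextended i nodeP s u (l ∷ acc) (∉-++ˡ (names u) (namesLeft C) hl)
        | ctxEdges-unextended i s C (r ∷ acc) (∉-++ʳ (names u) (namesLeft C) hl) hr = refl

unique-++ʳ : ∀ (X : List ℕ) {Y} → Unique (X ++ Y) → Unique Y
unique-++ʳ [] u = u
unique-++ʳ (x ∷ X) (_ ∷ u) = unique-++ʳ X u

unique-++-disjoint : ∀ (X : List ℕ) {Y j} → Unique (X ++ Y) → j ∈ X → j ∈ Y → ⊥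
unique-++-disjoint (x ∷ X) (h ∷ u) (here refl) my = All.lookup h (∈-++⁺ʳ X my) refl
unique-++-disjoint (x ∷ X) (h ∷ u) (there mx) my = unique-++-disjoint X u mx my

unique-++ˡ : ∀ (X : List ℕ) {Y} → Unique (X ++ Y) → Unique X
unique-++ˡ [] u = []
unique-++ˡ (x ∷ X) (h ∷ u) = All.tabulate (λ m → All.lookup h (∈-++⁺ˡ m)) ∷ unique-++ˡ X u

unique-plug : ∀ {A} (C : Ctx A) T {i} → Unique (names (plug C T)) → i ∈ names T →
  Unique (names T) × i ∉ namesLeft C × i ∉ namesRight C
unique-plug C T {i} u m with subst Unique (names-plug C T) u
... | u' = unique-++ˡ (names T) (unique-++ʳ (namesLeft C) u') ,
           (λ ml → unique-++-disjoint (namesLeft C) u' ml (∈-++⁺ˡ m)) ,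
           (λ mr → unique-++-disjoint (names T) (unique-++ʳ (namesLeft C) u') m mr)

∈-after₂-++ˡ : ∀ {x a b} {A B : List Vertex} → x ∈ A → x ∈ a ∷ b ∷ A ++ B
∈-after₂-++ˡ m = there (there (∈-++⁺ˡ m))

∈-after₂-++ʳ : ∀ {x a b} (A : List Vertex) {B} → x ∈ B → x ∈ a ∷ b ∷ A ++ B
∈-after₂-++ʳ A m = there (there (∈-++⁺ʳ A m))

⊆-remove-mid-last-to-front : ∀ (v w z : Vertex) (A B : List Vertex) → w ∈ v ∷ z ∷ A ++ B →
  (v ∷ A ++ (w ∷ B ++ z ∷ [])) ⊆ (v ∷ z ∷ A ++ B)
⊆-remove-mid-last-to-front v w z A B mw (here e) = here e
⊆-remove-mid-last-to-front v w z A B mw (there m) with ∈-++⁻ A m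
... | inj₁ ma = ∈-after₂-++ˡ ma
... | inj₂ (here refl) = mw
... | inj₂ (there m') with ∈-++⁻ B m'
...   | inj₁ mb = ∈-after₂-++ʳ A mb
...   | inj₂ (here refl) = there (here refl)

⊆-front-to-last-add-mid : ∀ (v w z : Vertex) (A B : List Vertex) → (v ∷ z ∷ A ++ B) ⊆ (v ∷ A ++ (w ∷ B ++ z ∷ []))
⊆-front-to-last-add-mid v w z A B (here e) = here e
⊆-front-to-last-add-mid v w z A B (there (here refl)) = there (∈-++⁺ʳ A (there (∈-++⁺ʳ B (here refl))))
⊆-front-to-last-add-mid v w z A B (there (there m)) with ∈-++⁻ A m
... | inj₁ ma = there (∈-++⁺ˡ ma)
... | inj₂ mb = there (∈-++⁺ʳ A (there (∈-++⁺ˡ mb)))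

⊆-remove-first-last-to-front : ∀ (v w z : Vertex) (A B : List Vertex) → w ∈ v ∷ z ∷ A ++ B →
  (v ∷ (w ∷ A ++ B) ++ z ∷ []) ⊆ (v ∷ z ∷ A ++ B)
⊆-remove-first-last-to-front v w z A B mw (here e) = here e
⊆-remove-first-last-to-front v w z A B mw (there (here refl)) = mw
⊆-remove-first-last-to-front v w z A B mw (there (there m)) with ∈-++⁻ (A ++ B) m
... | inj₁ m' = there (there m')
... | inj₂ (here refl) = there (here refl)

⊆-front-to-last-add-first : ∀ (v w z : Vertex) (A B : List Vertex) →
  (v ∷ z ∷ A ++ B) ⊆ (v ∷ (w ∷ A ++ B) ++ z ∷ [])
⊆-front-to-last-add-first v w z A B (here e) = here e
⊆-front-to-last-add-first v w z A B (there (here refl)) = there (there (∈-++⁺ʳ (A ++ B) (here refl)))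
⊆-front-to-last-add-first v w z A B (there (there m)) = there (there (∈-++⁺ˡ m))

↭-pair-to-front : ∀ {X : Set} (a b : X) (T Z : List X) → T ++ a ∷ b ∷ Z ↭ b ∷ a ∷ T ++ Z
↭-pair-to-front a b T Z = ↭-trans (shift a T (b ∷ Z)) (↭-trans (prep a (shift b T Z)) (swap a b ↭-refl))

↭-pull-second : ∀ {X : Set} (T : List X) (c e : X) Z → T ++ c ∷ e ∷ Z ↭ e ∷ T ++ c ∷ Z
↭-pull-second T c e Z = ↭-trans (↭-reflexive (sym (LP.++-assoc T (c ∷ []) (e ∷ Z))))
  (↭-trans (shift e (T ++ c ∷ []) Z) (prep e (↭-reflexive (LP.++-assoc T (c ∷ []) Z))))

module Switch {A : Set} (C : Ctx A) (Γ : Sequent A) (Q R : Tree A) (i : ℕ) (s2 : Switching) where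
  P = holePath C []
  ⊥ᵢ : Tree A
  ⊥ᵢ = leaf (bot , i)
  T1 = Q ⅋ (R ⊗ ⊥ᵢ)
  T2 = (Q ⅋ R) ⊗ ⊥ᵢ
  F = relocate P assocˡ
  F-local = relocate-local P assocˡ refl
  root = nodeP P
  tensor1 = nodeP (r ∷ P)
  par2 = nodeP (l ∷ P)
  botV = leafV i
  tQ2 = treeEdges nothing nodeP s2 Q (l ∷ l ∷ P)
  tR2 = treeEdges nothing nodeP s2 R (r ∷ l ∷ P)
  rQ2 = rootV nodeP Q (l ∷ l ∷ P)
  rR2 = rootV nodeP R (r ∷ l ∷ P)
  vQ2 = treeVerts nodeP Q (l ∷ l ∷ P)
  vR2 = treeVerts nodeP R (r ∷ l ∷ P)
  starVerts : List Vertex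
  starVerts = nodeP P ∷ botV ∷ vQ2 ++ vR2
  star : Vertex → List Edge
  star X = (botV , nodeP P) ∷ (X , nodeP P) ∷ tQ2 ++ tR2
  B2 = outerEdges nothing s2 C Γ
  M2 = treeEdges nothing nodeP s2 T2 P

  T2-edges : M2 ≡ (par2 , root) ∷ (botV , root) ∷ ((pick (s2 par2) ((rR2 , par2) ∷ []) ((rQ2 , par2) ∷ []) ++ tQ2 ++ tR2) ++ [])
  T2-edges rewrite treeEdges-⅋ nothing nodeP s2 Q R (l ∷ P) = refl

  par2≢root : par2 ≢ root
  par2≢root e = root≢child P l (sym e)

  h = merge par2 root
  h-local = merge-child-local P l root
  h-Q : ∀ y → h (nodeP (y ++ l ∷ l ∷ P)) ≡ nodeP (y ++ l ∷ l ∷ P)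
  h-Q y = merge-other par2 root _ (nodeP-≢ (below≢ y l (l ∷ P)))
  h-R : ∀ y → h (nodeP (y ++ r ∷ l ∷ P)) ≡ nodeP (y ++ r ∷ l ∷ P)
  h-R y = merge-other par2 root _ (nodeP-≢ (below≢ y r (l ∷ P)))
  h-rQ : h rQ2 ≡ rQ2
  h-rQ = rootV-move h Q _ _ (h-Q []) (fixes-leaves h-local)
  h-rR : h rR2 ≡ rR2
  h-rR = rootV-move h R _ _ (h-R []) (fixes-leaves h-local)

  target : ∀ X → pick (s2 par2) ((rR2 , par2) ∷ []) ((rQ2 , par2) ∷ []) ≡ (X , par2) ∷ [] → h X ≡ X →
    SpanningTree (B2 ++ star X) (outerVerts C Γ ++ starVerts) → SpanningTree (B2 ++ M2) (verts (plug C T2) Γ)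
  target X ek hX tt = transfer-expand C Γ T2 s2 h par2 root M2 L2 (star X) starVerts h-local par2≢root
      (sym (merge-collapses par2 root (root≢child P l)))
      (λ x y e → reach-flip (merge-fibre par2 root x y e)) pM2 pL verts-⊆starVerts tt
    where
    L2 = (botV , root) ∷ (((X , par2) ∷ tQ2 ++ tR2) ++ [])
    pM2 : M2 ↭ (par2 , root) ∷ L2
    pM2 rewrite T2-edges | ek = ↭-refl
    eT : mapEdges h (tQ2 ++ tR2) ≡ tQ2 ++ tR2
    eT = trans (mapEdges-++ h tQ2 _) (cong₂ _++_ (treeEdges-move nothing s2 s2 h Q _ _ h-Q (λ y → refl) (fixes-leaves h-local))
           (treeEdges-move nothing s2 s2 h R _ _ h-R (λ y → refl) (fixes-leaves h-local)))
    pL : mapEdges h L2 ↭ star X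
    pL = ↭-reflexive (cong₂ _∷_ (cong₂ _,_ refl (local-root h-local))
           (trans (cong (mapEdges h) (LP.++-identityʳ ((X , par2) ∷ tQ2 ++ tR2)))
               (cong₂ _∷_ (cong₂ _,_ hX (merge-self par2 root)) eT)))
    map-verts : map h (treeVerts nodeP T2 P) ≡ nodeP P ∷ (nodeP P ∷ vQ2 ++ vR2) ++ botV ∷ []
    map-verts = cong₂ _∷_ (local-root h-local) (trans (LP.map-++ h (par2 ∷ vQ2 ++ vR2) (botV ∷ []))
           (cong (_++ botV ∷ []) (cong₂ _∷_ (merge-self par2 root) (trans (LP.map-++ h vQ2 vR2)
             (cong₂ _++_ (treeVerts-move h Q _ _ h-Q (fixes-leaves h-local))
                 (treeVerts-move h R _ _ h-R (fixes-leaves h-local)))))))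
    verts-⊆starVerts : map h (treeVerts nodeP T2 P) ⊆ starVerts
    verts-⊆starVerts {x} m = ⊆-remove-first-last-to-front (nodeP P) (nodeP P) botV vQ2 vR2 (here refl)
        (subst (x ∈_) map-verts m)

  module Source (d : Dir) (u : Vertex) (merge-u-local : Local P (merge tensor1 u)) where
    s1 : Switching
    s1 = override root d (λ v → s2 (F v))
    σ = merge tensor1 u
    g : Vertex → Vertex
    g v = F (σ v)
    g-local : Local P g
    g-local = local-∘ merge-u-local F-local
    s1-elsewhere : ∀ v → v ≢ root → s1 v ≡ s2 (F v)
    s1-elsewhere v a = override-other root d _ v a
    agree : AgreeOutside P s1 s2
    agree = (λ y o → trans (s1-elsewhere (nodeP y) (λ e → o [] (nodeP-inj e)))
        (cong s2 (fixes-outside F-local y (outside⇒notProperlyBelow o)))) , (λ k q → refl)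
    tQ1 = treeEdges nothing nodeP s1 Q (l ∷ P)
    tR1 = treeEdges nothing nodeP s1 R (l ∷ r ∷ P)
    rQ1 = rootV nodeP Q (l ∷ P)
    rR1 = rootV nodeP R (l ∷ r ∷ P)
    vQ1 = treeVerts nodeP Q (l ∷ P)
    vR1 = treeVerts nodeP R (l ∷ r ∷ P)
    M1 = treeEdges nothing nodeP s1 T1 P
    T1-edges : M1 ≡ pick d ((tensor1 , root) ∷ []) ((rQ1 , root) ∷ []) ++ tQ1 ++
        ((rR1 , tensor1) ∷ (botV , tensor1) ∷ (tR1 ++ []))
    T1-edges rewrite treeEdges-⅋ nothing nodeP s1 Q (R ⊗ ⊥ᵢ) P | override-self root d (λ v → s2 (F v)) = refl
    g-Q : ∀ y → g (nodeP (y ++ l ∷ P)) ≡ nodeP (y ++ l ∷ l ∷ P)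
    g-Q y = trans (cong F (merge-other tensor1 u _ (nodeP-≢ (beside≢ y l r P (λ ())))))
        (relocate-below P assocˡ (l ∷ []) (l ∷ l ∷ []) (λ w → refl) y)
    g-R : ∀ y → g (nodeP (y ++ l ∷ r ∷ P)) ≡ nodeP (y ++ r ∷ l ∷ P)
    g-R y = trans (cong F (merge-other tensor1 u _ (nodeP-≢ (below≢ y l (r ∷ P)))))
        (relocate-below P assocˡ (r ∷ l ∷ []) (l ∷ r ∷ []) (λ w → refl) y)
    s1-Q : ∀ y → s1 (nodeP (y ++ l ∷ P)) ≡ s2 (nodeP (y ++ l ∷ l ∷ P))
    s1-Q y = trans (s1-elsewhere _ (nodeP-≢ (below≢ y l P)))
        (cong s2 (relocate-below P assocˡ (l ∷ []) (l ∷ l ∷ []) (λ w → refl) y))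
    s1-R : ∀ y → s1 (nodeP (y ++ l ∷ r ∷ P)) ≡ s2 (nodeP (y ++ r ∷ l ∷ P))
    s1-R y = trans (s1-elsewhere _ (nodeP-≢ (below₂≢ y l r P)))
        (cong s2 (relocate-below P assocˡ (r ∷ l ∷ []) (l ∷ r ∷ []) (λ w → refl) y))
    g-tQ : mapEdges g tQ1 ≡ tQ2
    g-tQ = treeEdges-move nothing s1 s2 g Q _ _ g-Q s1-Q (fixes-leaves g-local)
    g-tR : mapEdges g tR1 ≡ tR2
    g-tR = treeEdges-move nothing s1 s2 g R _ _ g-R s1-R (fixes-leaves g-local)
    g-rQ : g rQ1 ≡ rQ2
    g-rQ = rootV-move g Q _ _ (g-Q []) (fixes-leaves g-local)
    g-rR : g rR1 ≡ rR2
    g-rR = rootV-move g R _ _ (g-R []) (fixes-leaves g-local)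
    g-root : g root ≡ nodeP P
    g-root = local-root g-local
    map-verts : map g (treeVerts nodeP T1 P) ≡ nodeP P ∷ vQ2 ++ (g tensor1 ∷ vR2 ++ botV ∷ [])
    map-verts = cong₂ _∷_ g-root (trans (LP.map-++ g vQ1 _)
        (cong₂ _++_ (treeVerts-move g Q _ _ g-Q (fixes-leaves g-local))
           (cong (g tensor1 ∷_) (trans (LP.map-++ g vR1 (botV ∷ []))
               (cong (_++ botV ∷ []) (treeVerts-move g R _ _ g-R (fixes-leaves g-local)))))))
    starVerts-⊆ : starVerts ⊆ map g (treeVerts nodeP T1 P)
    starVerts-⊆ {x} m = subst (x ∈_) (sym map-verts) (⊆-front-to-last-add-mid (nodeP P) (g tensor1) botV vQ2 vR2 m)

  source-star-R : AllSwitchingsTrees (plug C T1) Γ → SpanningTree (B2 ++ star rR2) (outerVerts C Γ ++ starVerts)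
  source-star-R H = transfer-contract C Γ T1 s1 s2 g ((tensor1 , root) ∷ []) M1 L1 (star rR2) starVerts g-local
      agree col fib pM1 pL starVerts-⊆ (split-graph C Γ s1 inner⅋ (H s1))
    where
    open Source l root (merge-child-local P r root)
    L1 = tQ1 ++ ((rR1 , tensor1) ∷ (botV , tensor1) ∷ (tR1 ++ []))
    col : ∀ {a b} → (a , b) ∈ (tensor1 , root) ∷ [] → g a ≡ g b
    col (here refl) = cong F (sym (merge-collapses tensor1 root (root≢child P r)))
    fib : ∀ x y → g x ≡ g y → Reach ((tensor1 , root) ∷ []) x y
    fib x y e = reach-flip (merge-fibre tensor1 root x y
        (relocate-injective P assocˡ (inverse⇒injective assocʳ assocʳ-assocˡ) _ _ e))
    pM1 : M1 ↭ ((tensor1 , root) ∷ []) ++ L1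
    pM1 rewrite T1-edges = ↭-refl
    g-tensor1 : g tensor1 ≡ nodeP P
    g-tensor1 = trans (cong F (merge-self tensor1 root)) (local-root F-local)
    pL : mapEdges g L1 ↭ star rR2
    pL = ↭-trans (↭-reflexive (trans (mapEdges-++ g tQ1 _) (cong₂ _++_ g-tQ
           (cong₂ _∷_ (cong₂ _,_ g-rR g-tensor1) (cong₂ _∷_ (cong₂ _,_ refl g-tensor1)
               (trans (cong (mapEdges g) (LP.++-identityʳ tR1)) g-tR))))))
         (↭-pair-to-front _ _ tQ2 tR2)

  ∈-verts-plug : ∀ (T : Tree A) {x} → x ∈ treeVerts nodeP T P → x ∈ verts (plug C T) Γ
  ∈-verts-plug T m = ∈-resp-↭ (↭-sym (verts-plug C Γ)) (∈-++⁺ʳ (outerVerts C Γ) m)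

  module KeepQ = Source r (rootV nodeP R (l ∷ r ∷ P)) (merge-child-local P r _)

  -- With the edge from ⊥ᵢ removed, the switching graph of T₁ keeping Q is the extended switching
  -- graph of the side condition.
  detached-edges : List Edge
  detached-edges = outerEdges nothing KeepQ.s1 C Γ ++ (KeepQ.rQ1 , root) ∷ KeepQ.tQ1 ++
      ((KeepQ.rR1 , tensor1) ∷ (KeepQ.tR1 ++ []))

  detached-edges-extended : PreProof (plug C T1) Γ → detached-edges ↭ switchGraph (just i) KeepQ.s1 (plug C T1) Γ
  detached-edges-extended pp = ↭-sym (↭-trans (switchGraph-plug (just i) s1 C Γ inner⅋)
      (↭-reflexive (cong₂ _++_ (cong (_++ seqEdges s1 Γ 0) (ctxEdges-unextended i s1 C [] (proj₁ (proj₂ unique))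
        (proj₂ (proj₂ unique)))) local-edges)))
    where
    open KeepQ
    names-T1 : names T1 ≡ names Q ++ names R ++ i ∷ []
    names-T1 = trans (names-⅋ Q (R ⊗ ⊥ᵢ)) (cong (names Q ++_) (names-⊗ R ⊥ᵢ))
    unique = unique-plug C T1 (proj₁ (proj₂ pp)) (subst (i ∈_) (sym names-T1)
        (∈-++⁺ʳ (names Q) (∈-++⁺ʳ (names R) (here refl))))
    unique-T1 : Unique (names Q ++ names R ++ i ∷ [])
    unique-T1 = subst Unique names-T1 (proj₁ unique)
    i∉Q : i ∉ names Q
    i∉Q mq = unique-++-disjoint (names Q) unique-T1 mq (∈-++⁺ʳ (names R) (here refl))
    i∉R : i ∉ names R
    i∉R mr = unique-++-disjoint (names R) (unique-++ʳ (names Q) unique-T1) mr (here refl)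
    local-edges : treeEdges (just i) nodeP s1 T1 P ≡ (rQ1 , root) ∷ tQ1 ++ ((rR1 , tensor1) ∷ (tR1 ++ []))
    local-edges = trans (treeEdges-⅋ (just i) nodeP s1 Q (R ⊗ ⊥ᵢ) P)
      (cong₂ _++_ (trans (cong (λ d → pick d (childEdge (just i) nodeP (R ⊗ ⊥ᵢ) (r ∷ P) root)
          (childEdge (just i) nodeP Q (l ∷ P) root))
                               (override-self root r (λ v → s2 (F v))))
                         (childEdge-unextended i nodeP Q (l ∷ P) root i∉Q))
        (cong₂ _++_ (treeEdges-unextended i nodeP s1 Q (l ∷ P) i∉Q)
          (cong₂ _++_ (childEdge-unextended i nodeP R (l ∷ r ∷ P) tensor1 i∉R)
            (cong₂ _++_ (childEdge-removed {A} i nodeP bot (r ∷ r ∷ P) tensor1)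
              (cong (_++ []) (treeEdges-unextended i nodeP s1 R (l ∷ r ∷ P) i∉R))))))

  -- This is the one place where the side condition is used: ⊥ᵢ can be reattached from the ⊗-node to the root.
  reattach-bot : PreProof (plug C T1) Γ → SideCond Γ C Q R i → AllSwitchingsTrees (plug C T1) Γ →
    SpanningTree (outerEdges nothing KeepQ.s1 C Γ ++ (botV , root) ∷ (KeepQ.rQ1 , root) ∷ KeepQ.tQ1 ++
        ((KeepQ.rR1 , tensor1) ∷ (KeepQ.tR1 ++ [])))
                 (verts (plug C T1) Γ)
  reattach-bot pp sc H = spanningTree-↭ (↭-sym (shift (botV , root) B1 _))
    (exchange-edge botV tensor1 botV root detached-edges _
      (∈-verts-plug T1 (there (∈-++⁺ʳ vQ1 (there (∈-++⁺ʳ vR1 (here refl)))))) (∈-verts-plug T1 (here refl)) bot-detached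
      (spanningTree-↭ detach (split-graph C Γ s1 inner⅋ (H s1))))
    where
    open KeepQ
    B1 = outerEdges nothing s1 C Γ
    detach : B1 ++ M1 ↭ (botV , tensor1) ∷ detached-edges
    detach rewrite T1-edges = ↭-trans (++⁺ˡ B1 (↭-pull-second ((rQ1 , root) ∷ tQ1) (rR1 , tensor1) (botV , tensor1) (tR1 ++ [])))
                                     (shift (botV , tensor1) B1 _)
    bot-detached : ¬ Reach detached-edges botV root
    bot-detached ρ = sc s1 rQ1 (rootV∈treeVerts Q _)
      (reach⇒trail (reach-↭ (detached-edges-extended pp) (along (∈-++⁺ʳ B1 (here refl)) ◅◅ reach-sym ρ)))

  source-star-Q : PreProof (plug C T1) Γ → SideCond Γ C Q R i → AllSwitchingsTrees (plug C T1) Γ →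
    SpanningTree (B2 ++ star rQ2) (outerVerts C Γ ++ starVerts)
  source-star-Q pp sc H = transfer-contract C Γ T1 s1 s2 g ((rR1 , tensor1) ∷ []) _ L1 (star rQ2) starVerts g-local agree
      collapses fibre (shift (rR1 , tensor1) ((botV , root) ∷ (rQ1 , root) ∷ tQ1) (tR1 ++ [])) g-L1 starVerts-⊆
      (reattach-bot pp sc H)
    where
    open KeepQ
    rR≢tensor1 : rR1 ≢ tensor1
    rR≢tensor1 = rootV≢ R _ _ (nodeP-≢ (below≢ [] l (r ∷ P))) (λ _ ())
    L1 = (botV , root) ∷ (rQ1 , root) ∷ tQ1 ++ (tR1 ++ [])
    collapses : ∀ {a b} → (a , b) ∈ (rR1 , tensor1) ∷ [] → g a ≡ g b
    collapses (here refl) = cong F (merge-collapses tensor1 rR1 rR≢tensor1)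
    fibre : ∀ x y → g x ≡ g y → Reach ((rR1 , tensor1) ∷ []) x y
    fibre x y e = merge-fibre tensor1 rR1 x y (relocate-injective P assocˡ (inverse⇒injective assocʳ assocʳ-assocˡ) _ _ e)
    g-L1 : mapEdges g L1 ↭ star rQ2
    g-L1 = ↭-reflexive (cong₂ _∷_ (cong₂ _,_ refl g-root) (cong₂ _∷_ (cong₂ _,_ g-rQ g-root)
             (trans (mapEdges-++ g tQ1 _) (cong₂ _++_ g-tQ
                 (trans (cong (mapEdges g) (LP.++-identityʳ tR1)) g-tR)))))

switch-correct : ∀ {A} (C : Ctx A) Γ (Q R : Tree A) i → PreProof (plug C (Q ⅋ (R ⊗ leaf (bot , i)))) Γ →
  SideCond Γ C Q R i →
  AllSwitchingsTrees (plug C (Q ⅋ (R ⊗ leaf (bot , i)))) Γ →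
      AllSwitchingsTrees (plug C ((Q ⅋ R) ⊗ leaf (bot , i))) Γ
switch-correct C Γ Q R i pp sc H s2 = unsplit-graph C Γ s2 inner⊗ (by-cases (s2 par2) refl)
  where
  open Switch C Γ Q R i s2
  kept : ∀ {d d'} → d ≡ d' → pick d ((rR2 , par2) ∷ []) ((rQ2 , par2) ∷ []) ≡ pick d' ((rR2 , par2) ∷ [])
      ((rQ2 , par2) ∷ [])
  kept refl = refl
  by-cases : ∀ d → s2 par2 ≡ d → SpanningTree (B2 ++ M2) (verts (plug C T2) Γ)
  by-cases l e = target rR2 (kept e) h-rR (source-star-R H)
  by-cases r e = target rQ2 (kept e) h-rQ (source-star-Q pp sc H)

module Switch⁻¹ {A : Set} (C : Ctx A) (Γ : Sequent A) (Q R : Tree A) (i : ℕ) (s1 : Switching) where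
  P = holePath C []
  ⊥ᵢ : Tree A
  ⊥ᵢ = leaf (bot , i)
  T1 = Q ⅋ (R ⊗ ⊥ᵢ)
  T2 = (Q ⅋ R) ⊗ ⊥ᵢ
  F = relocate P assocʳ
  F-local = relocate-local P assocʳ refl
  root = nodeP P
  tensor1 = nodeP (r ∷ P)
  par2 = nodeP (l ∷ P)
  botV = leafV i
  tQ1 = treeEdges nothing nodeP s1 Q (l ∷ P)
  tR1 = treeEdges nothing nodeP s1 R (l ∷ r ∷ P)
  rQ1 = rootV nodeP Q (l ∷ P)
  rR1 = rootV nodeP R (l ∷ r ∷ P)
  vQ1 = treeVerts nodeP Q (l ∷ P)
  vR1 = treeVerts nodeP R (l ∷ r ∷ P)
  starVerts : List Vertex
  starVerts = nodeP P ∷ botV ∷ vQ1 ++ vR1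
  star : Vertex → List Edge
  star X = (botV , nodeP P) ∷ (X , nodeP P) ∷ tQ1 ++ tR1
  B1 = outerEdges nothing s1 C Γ
  M1 = treeEdges nothing nodeP s1 T1 P

  T1-edges : M1 ≡ pick (s1 root) ((tensor1 , root) ∷ []) ((rQ1 , root) ∷ []) ++ tQ1 ++
      ((rR1 , tensor1) ∷ (botV , tensor1) ∷ (tR1 ++ []))
  T1-edges rewrite treeEdges-⅋ nothing nodeP s1 Q (R ⊗ ⊥ᵢ) P = refl

  module Source (d' : Dir) where
    s2 : Switching
    s2 = override par2 d' (λ v → s1 (F v))
    σ = merge par2 root
    g : Vertex → Vertex
    g v = F (σ v)
    g-local : Local P g
    g-local = local-∘ (merge-child-local P l root) F-local
    s2-elsewhere : ∀ v → v ≢ par2 → s2 v ≡ s1 (F v)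
    s2-elsewhere v a = override-other par2 d' _ v a
    agree : AgreeOutside P s2 s1
    agree = (λ y o → trans (s2-elsewhere (nodeP y) (λ e → o (l ∷ []) (nodeP-inj e)))
        (cong s1 (fixes-outside F-local y (outside⇒notProperlyBelow o)))) , (λ k q → refl)
    tQ2 = treeEdges nothing nodeP s2 Q (l ∷ l ∷ P)
    tR2 = treeEdges nothing nodeP s2 R (r ∷ l ∷ P)
    rQ2 = rootV nodeP Q (l ∷ l ∷ P)
    rR2 = rootV nodeP R (r ∷ l ∷ P)
    vQ2 = treeVerts nodeP Q (l ∷ l ∷ P)
    vR2 = treeVerts nodeP R (r ∷ l ∷ P)
    M2 = treeEdges nothing nodeP s2 T2 P
    T2-edges : M2 ≡ (par2 , root) ∷ (botV , root) ∷
        ((pick d' ((rR2 , par2) ∷ []) ((rQ2 , par2) ∷ []) ++ tQ2 ++ tR2) ++ [])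
    T2-edges rewrite treeEdges-⅋ nothing nodeP s2 Q R (l ∷ P) | override-self par2 d' (λ v → s1 (F v)) = refl
    g-Q : ∀ y → g (nodeP (y ++ l ∷ l ∷ P)) ≡ nodeP (y ++ l ∷ P)
    g-Q y = trans (cong F (merge-other par2 root _ (nodeP-≢ (below≢ y l (l ∷ P)))))
        (relocate-below P assocʳ (l ∷ l ∷ []) (l ∷ []) (λ w → refl) y)
    g-R : ∀ y → g (nodeP (y ++ r ∷ l ∷ P)) ≡ nodeP (y ++ l ∷ r ∷ P)
    g-R y = trans (cong F (merge-other par2 root _ (nodeP-≢ (below≢ y r (l ∷ P)))))
        (relocate-below P assocʳ (l ∷ r ∷ []) (r ∷ l ∷ []) (λ w → refl) y)
    s2-Q : ∀ y → s2 (nodeP (y ++ l ∷ l ∷ P)) ≡ s1 (nodeP (y ++ l ∷ P))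
    s2-Q y = trans (s2-elsewhere _ (nodeP-≢ (below≢ y l (l ∷ P))))
        (cong s1 (relocate-below P assocʳ (l ∷ l ∷ []) (l ∷ []) (λ w → refl) y))
    s2-R : ∀ y → s2 (nodeP (y ++ r ∷ l ∷ P)) ≡ s1 (nodeP (y ++ l ∷ r ∷ P))
    s2-R y = trans (s2-elsewhere _ (nodeP-≢ (below≢ y r (l ∷ P))))
        (cong s1 (relocate-below P assocʳ (l ∷ r ∷ []) (r ∷ l ∷ []) (λ w → refl) y))
    g-subtrees : mapEdges g (tQ2 ++ tR2) ≡ tQ1 ++ tR1
    g-subtrees = trans (mapEdges-++ g tQ2 _) (cong₂ _++_ (treeEdges-move nothing s2 s1 g Q _ _ g-Q s2-Q (fixes-leaves g-local)) (treeEdges-move nothing s2 s1 g R _ _ g-R s2-R (fixes-leaves g-local)))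
    g-rQ : g rQ2 ≡ rQ1
    g-rQ = rootV-move g Q _ _ (g-Q []) (fixes-leaves g-local)
    g-rR : g rR2 ≡ rR1
    g-rR = rootV-move g R _ _ (g-R []) (fixes-leaves g-local)
    g-par2 : g par2 ≡ nodeP P
    g-par2 = trans (cong F (merge-self par2 root)) (local-root F-local)
    map-verts : map g (treeVerts nodeP T2 P) ≡ nodeP P ∷ (nodeP P ∷ vQ1 ++ vR1) ++ botV ∷ []
    map-verts = cong₂ _∷_ (local-root g-local) (trans (LP.map-++ g (par2 ∷ vQ2 ++ vR2) (botV ∷ []))
           (cong (_++ botV ∷ []) (cong₂ _∷_ g-par2 (trans (LP.map-++ g vQ2 vR2)
             (cong₂ _++_ (treeVerts-move g Q _ _ g-Q (fixes-leaves g-local))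
                 (treeVerts-move g R _ _ g-R (fixes-leaves g-local)))))))
    starVerts-⊆ : starVerts ⊆ map g (treeVerts nodeP T2 P)
    starVerts-⊆ {x} m = subst (x ∈_) (sym map-verts) (⊆-front-to-last-add-first (nodeP P) (nodeP P) botV vQ1 vR1 m)
    source-star : ∀ X2 X1 → pick d' ((rR2 , par2) ∷ []) ((rQ2 , par2) ∷ []) ≡ (X2 , par2) ∷ [] → g X2 ≡ X1 →
      AllSwitchingsTrees (plug C T2) Γ → SpanningTree (B1 ++ star X1) (outerVerts C Γ ++ starVerts)
    source-star X2 X1 ek eX H = transfer-contract C Γ T2 s2 s1 g ((par2 , root) ∷ []) M2 L2 (star X1) starVerts g-local
        agree col fib pM2 pL starVerts-⊆ (split-graph C Γ s2 inner⊗ (H s2))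
      where
      L2 = (botV , root) ∷ (((X2 , par2) ∷ tQ2 ++ tR2) ++ [])
      col : ∀ {a b} → (a , b) ∈ (par2 , root) ∷ [] → g a ≡ g b
      col (here refl) = cong F (sym (merge-collapses par2 root (root≢child P l)))
      fib : ∀ x y → g x ≡ g y → Reach ((par2 , root) ∷ []) x y
      fib x y e = reach-flip (merge-fibre par2 root x y
          (relocate-injective P assocʳ (inverse⇒injective assocˡ assocˡ-assocʳ) _ _ e))
      pM2 : M2 ↭ ((par2 , root) ∷ []) ++ L2
      pM2 rewrite T2-edges | ek = ↭-refl
      pL : mapEdges g L2 ↭ star X1
      pL = ↭-reflexive (cong₂ _∷_ (cong₂ _,_ refl (local-root g-local))
             (trans (cong (mapEdges g) (LP.++-identityʳ ((X2 , par2) ∷ tQ2 ++ tR2)))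
                 (cong₂ _∷_ (cong₂ _,_ eX g-par2) g-subtrees)))

  source-star-Q : AllSwitchingsTrees (plug C T2) Γ → SpanningTree (B1 ++ star rQ1) (outerVerts C Γ ++ starVerts)
  source-star-Q = Source.source-star r (rootV nodeP Q (l ∷ l ∷ P)) rQ1 refl (Source.g-rQ r)

  source-star-R : AllSwitchingsTrees (plug C T2) Γ → SpanningTree (B1 ++ star rR1) (outerVerts C Γ ++ starVerts)
  source-star-R = Source.source-star l (rootV nodeP R (r ∷ l ∷ P)) rR1 refl (Source.g-rR l)

  module Target (u : Vertex) (merge-u-local : Local P (merge tensor1 u)) where
    h = merge tensor1 u
    h-Q : ∀ y → h (nodeP (y ++ l ∷ P)) ≡ nodeP (y ++ l ∷ P)
    h-Q y = merge-other tensor1 u _ (nodeP-≢ (beside≢ y l r P (λ ())))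
    h-R : ∀ y → h (nodeP (y ++ l ∷ r ∷ P)) ≡ nodeP (y ++ l ∷ r ∷ P)
    h-R y = merge-other tensor1 u _ (nodeP-≢ (below≢ y l (r ∷ P)))
    g-tQ : mapEdges h tQ1 ≡ tQ1
    g-tQ = treeEdges-move nothing s1 s1 h Q _ _ h-Q (λ y → refl) (fixes-leaves merge-u-local)
    g-tR : mapEdges h tR1 ≡ tR1
    g-tR = treeEdges-move nothing s1 s1 h R _ _ h-R (λ y → refl) (fixes-leaves merge-u-local)
    h-rQ : h rQ1 ≡ rQ1
    h-rQ = rootV-move h Q _ _ (h-Q []) (fixes-leaves merge-u-local)
    h-rR : h rR1 ≡ rR1
    h-rR = rootV-move h R _ _ (h-R []) (fixes-leaves merge-u-local)
    map-verts : map h (treeVerts nodeP T1 P) ≡ nodeP P ∷ vQ1 ++ (h tensor1 ∷ vR1 ++ botV ∷ [])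
    map-verts = cong₂ _∷_ (local-root merge-u-local)
        (trans (LP.map-++ h vQ1 _) (cong₂ _++_ (treeVerts-move h Q _ _ h-Q (fixes-leaves merge-u-local))
           (cong (h tensor1 ∷_) (trans (LP.map-++ h vR1 (botV ∷ []))
               (cong (_++ botV ∷ []) (treeVerts-move h R _ _ h-R (fixes-leaves merge-u-local)))))))
    verts-⊆starVerts : h tensor1 ∈ starVerts → map h (treeVerts nodeP T1 P) ⊆ starVerts
    verts-⊆starVerts mm {x} m = ⊆-remove-mid-last-to-front (nodeP P) (h tensor1) botV vQ1 vR1 mm
        (subst (x ∈_) map-verts m)

  target-keeps-Q : s1 root ≡ l → SpanningTree (B1 ++ star rR1) (outerVerts C Γ ++ starVerts) →
      SpanningTree (B1 ++ M1) (verts (plug C T1) Γ)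
  target-keeps-Q e tt = transfer-expand C Γ T1 s1 h tensor1 root M1 L1 (star rR1) starVerts
      (merge-child-local P r root) (λ e → root≢child P r (sym e))
      (sym (merge-collapses tensor1 root (root≢child P r))) (λ x y e → reach-flip (merge-fibre tensor1 root x y e)) pM1 pL
      (verts-⊆starVerts (subst (_∈ starVerts) (sym (merge-self tensor1 root)) (here refl))) tt
    where
    open Target root (merge-child-local P r root)
    L1 = tQ1 ++ ((rR1 , tensor1) ∷ (botV , tensor1) ∷ (tR1 ++ []))
    pM1 : M1 ↭ (tensor1 , root) ∷ L1
    pM1 rewrite T1-edges | e = ↭-refl
    pL : mapEdges h L1 ↭ star rR1
    pL = ↭-trans (↭-reflexive (trans (mapEdges-++ h tQ1 _) (cong₂ _++_ g-tQ
           (cong₂ _∷_ (cong₂ _,_ h-rR (merge-self tensor1 root))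
               (cong₂ _∷_ (cong₂ _,_ refl (merge-self tensor1 root))
             (trans (cong (mapEdges h) (LP.++-identityʳ tR1)) g-tR))))))
         (↭-pair-to-front _ _ tQ1 tR1)

  -- Both contractions of T₂ are trees, so removing the edge from ⊥ᵢ separates ⊥ᵢ from R; hence ⊥ᵢ
  -- may be reattached to the root of R.
  target-keeps-tensor : s1 root ≡ r → AllSwitchingsTrees (plug C T2) Γ →
      SpanningTree (B1 ++ M1) (verts (plug C T1) Γ)
  target-keeps-tensor e H = transfer-expand C Γ T1 s1 h botV tensor1 M1 L1 bot-on-R starVerts
      (merge-child-local P r botV) (λ ())
      (merge-collapses tensor1 botV (λ ())) (merge-fibre tensor1 botV) pM1 pL
      (verts-⊆starVerts (subst (_∈ starVerts) (sym (merge-self tensor1 botV)) (there (here refl))))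
      (spanningTree-↭ (↭-sym (shifts B1 ((rR1 , botV) ∷ (rQ1 , root) ∷ []))) reattached)
    where
    open Target botV (merge-child-local P r botV)
    shared = B1 ++ tQ1 ++ tR1
    V = outerVerts C Γ ++ starVerts
    star-Q : SpanningTree ((botV , root) ∷ (rQ1 , root) ∷ shared) V
    star-Q = spanningTree-↭ (shifts B1 ((botV , root) ∷ (rQ1 , root) ∷ [])) (source-star-Q H)
    star-R : SpanningTree ((botV , root) ∷ (rR1 , root) ∷ shared) V
    star-R = spanningTree-↭ (shifts B1 ((botV , root) ∷ (rR1 , root) ∷ [])) (source-star-R H)
    reattached : SpanningTree ((rR1 , botV) ∷ (rQ1 , root) ∷ shared) V
    reattached = exchange-edge botV root rR1 botV ((rQ1 , root) ∷ shared) V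
      (∈-++⁺ʳ (outerVerts C Γ) (∈-after₂-++ʳ vQ1 (rootV∈treeVerts R _)))
          (∈-++⁺ʳ (outerVerts C Γ) (there (here refl)))
      (λ ρ → siblings-separated botV root rQ1 rR1 shared V star-Q star-R (reach-sym ρ)) star-Q
    bot-on-R = (rR1 , botV) ∷ (rQ1 , root) ∷ tQ1 ++ tR1
    L1 = (rQ1 , root) ∷ tQ1 ++ ((rR1 , tensor1) ∷ (tR1 ++ []))
    pM1 : M1 ↭ (botV , tensor1) ∷ L1
    pM1 rewrite T1-edges | e = ↭-pull-second ((rQ1 , root) ∷ tQ1) (rR1 , tensor1) (botV , tensor1) (tR1 ++ [])
    pL : mapEdges h L1 ↭ bot-on-R
    pL = ↭-trans (↭-reflexive (cong₂ _∷_ (cong₂ _,_ h-rQ (local-root (merge-child-local P r botV)))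
           (trans (mapEdges-++ h tQ1 _) (cong₂ _++_ g-tQ (cong₂ _∷_ (cong₂ _,_ h-rR (merge-self tensor1 botV))
             (trans (cong (mapEdges h) (LP.++-identityʳ tR1)) g-tR))))))
         (shift (rR1 , botV) ((rQ1 , root) ∷ tQ1) tR1)

switch⁻¹-correct : ∀ {A} (C : Ctx A) Γ (Q R : Tree A) i →
  AllSwitchingsTrees (plug C ((Q ⅋ R) ⊗ leaf (bot , i))) Γ →
      AllSwitchingsTrees (plug C (Q ⅋ (R ⊗ leaf (bot , i)))) Γ
switch⁻¹-correct C Γ Q R i H s1 = unsplit-graph C Γ s1 inner⅋ (by-cases (s1 root) refl)
  where
  open Switch⁻¹ C Γ Q R i s1
  by-cases : ∀ d → s1 root ≡ d → SpanningTree (B1 ++ M1) (verts (plug C T1) Γ)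
  by-cases l e = target-keeps-Q e (source-star-R H)
  by-cases r e = target-keeps-tensor e H

-- Inverse steps

_∘ᶜ_ : ∀ {A} → Ctx A → Ctx A → Ctx A
hole ∘ᶜ D = D
⊗ₗ C u ∘ᶜ D = ⊗ₗ (C ∘ᶜ D) u
⊗ᵣ u C ∘ᶜ D = ⊗ᵣ u (C ∘ᶜ D)
⅋ₗ C u ∘ᶜ D = ⅋ₗ (C ∘ᶜ D) u
⅋ᵣ u C ∘ᶜ D = ⅋ᵣ u (C ∘ᶜ D)

plug-∘ᶜ : ∀ {A} (C D : Ctx A) t → plug (C ∘ᶜ D) t ≡ plug C (plug D t)
plug-∘ᶜ hole D t = refl
plug-∘ᶜ (⊗ₗ C u) D t = cong (_⊗ u) (plug-∘ᶜ C D t)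
plug-∘ᶜ (⊗ᵣ u C) D t = cong (u ⊗_) (plug-∘ᶜ C D t)
plug-∘ᶜ (⅋ₗ C u) D t = cong (_⅋ u) (plug-∘ᶜ C D t)
plug-∘ᶜ (⅋ᵣ u C) D t = cong (u ⅋_) (plug-∘ᶜ C D t)

module _ {A : Set} (C : Ctx A) (Γ : Sequent A) where

  tensor-commʳ-correct : ∀ (U Q R : Tree A) →
    AllSwitchingsTrees (plug C (U ⊗ (Q ⊗ R))) Γ → AllSwitchingsTrees (plug C (U ⊗ (R ⊗ Q))) Γ
  tensor-commʳ-correct U Q R =
    subst (λ T → AllSwitchingsTrees T Γ) (plug-∘ᶜ C (⊗ᵣ U hole) (R ⊗ Q))
    ∘ tensor-comm-correct (C ∘ᶜ ⊗ᵣ U hole) Γ Q R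
    ∘ subst (λ T → AllSwitchingsTrees T Γ) (sym (plug-∘ᶜ C (⊗ᵣ U hole) (Q ⊗ R)))

  bot-assoc⁻¹-correct : ∀ i (Q : Tree A) j →
    AllSwitchingsTrees (plug C ((leaf (bot , i) ⊗ Q) ⊗ leaf (bot , j))) Γ →
    AllSwitchingsTrees (plug C (leaf (bot , i) ⊗ (Q ⊗ leaf (bot , j)))) Γ
  bot-assoc⁻¹-correct i Q j =
    tensor-commʳ-correct ⊥ᵢ ⊥ⱼ Q
    ∘ tensor-comm-correct C Γ (⊥ⱼ ⊗ Q) ⊥ᵢ
    ∘ bot-assoc-correct C Γ j Q i
    ∘ tensor-commʳ-correct ⊥ⱼ ⊥ᵢ Q
    ∘ tensor-comm-correct C Γ (⊥ᵢ ⊗ Q) ⊥ⱼ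
    where
    ⊥ᵢ ⊥ⱼ : Tree A
    ⊥ᵢ = leaf (bot , i)
    ⊥ⱼ = leaf (bot , j)

  par-assoc⁻¹-correct : ∀ (Q R S : Tree A) →
    AllSwitchingsTrees (plug C (Q ⅋ (R ⅋ S))) Γ → AllSwitchingsTrees (plug C ((Q ⅋ R) ⅋ S)) Γ
  par-assoc⁻¹-correct Q R S =
    par-comm-correct C Γ S (Q ⅋ R)
    ∘ par-assoc-correct C Γ S Q R
    ∘ par-comm-correct C Γ R (S ⅋ Q)
    ∘ par-assoc-correct C Γ R S Q
    ∘ par-comm-correct C Γ Q (R ⅋ S)

step-correct : ∀ {A} {Γ : Sequent A} {P Q} → Step Γ P Q → PreProof P Γ → AllSwitchingsTrees P Γ →
  AllSwitchingsTrees Q Γ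
step-correct {Γ = Γ} (par-comm C Q R) pp = par-comm-correct C Γ Q R
step-correct {Γ = Γ} (par-assoc C Q R S) pp = par-assoc-correct C Γ Q R S
step-correct {Γ = Γ} (ten-comm C Q R) pp = tensor-comm-correct C Γ Q R
step-correct {Γ = Γ} (bot-assoc C i Q j) pp = bot-assoc-correct C Γ i Q j
step-correct {Γ = Γ} (switch C Q R i sc) pp = switch-correct C Γ Q R i pp sc

step⁻¹-correct : ∀ {A} {Γ : Sequent A} {P Q} → Step Γ Q P → AllSwitchingsTrees P Γ → AllSwitchingsTrees Q Γ
step⁻¹-correct {Γ = Γ} (par-comm C Q R) = par-comm-correct C Γ R Q
step⁻¹-correct {Γ = Γ} (par-assoc C Q R S) = par-assoc⁻¹-correct C Γ Q R S
step⁻¹-correct {Γ = Γ} (ten-comm C Q R) = tensor-comm-correct C Γ R Q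
step⁻¹-correct {Γ = Γ} (bot-assoc C i Q j) = bot-assoc⁻¹-correct C Γ i Q j
step⁻¹-correct {Γ = Γ} (switch C Q R i sc) = switch⁻¹-correct C Γ Q R i

symStep-correct : ∀ {A} {Γ : Sequent A} {P Q} → PreProof P Γ → (Step Γ P Q ⊎ Step Γ Q P) → AllSwitchingsTrees P Γ →
  AllSwitchingsTrees Q Γ
symStep-correct pp (inj₁ x) = step-correct x pp
symStep-correct pp (inj₂ y) = step⁻¹-correct y

symStep-preserves-correct : ∀ {A} {Γ : Sequent A} {P Q} → SymStep Γ P Q → Correct P Γ → Correct Q Γ
symStep-preserves-correct (ppP , ppQ , st) (_ , trees) =
  ppQ , spanningTree⇒connectedAcyclic ∘ symStep-correct ppP st (connectedAcyclic⇒spanningTree ∘ trees)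

lemma1p9 : {A : Set} (Γ : Sequent A) (P P' : Tree A) →
  Correct P Γ → Equiv Γ P P' → Correct P' Γ
lemma1p9 Γ P .P c ε = c
lemma1p9 Γ P P' c (st ◅ rest) = lemma1p9 Γ _ P' (symStep-preserves-correct st c) rest
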